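{- Let $n,c,m$ be positive integers and $a\in\{1,\dots,c\}$. Let $P_{m+1}$ denote the colored pattern $1^a1^a\cdots1^a$ of length $m+1$. Then $$\left|\Pi_n^{eq}\wr C_c(P_{m+1})\right|=\sum_{(p_1,\dots,p_k)\vdash n}\binom{n}{p_1,p_2,\dots,p_k}\prod_{i=1}^n\frac{1}{(\#p(i))!}\prod_{i=1}^k\left(\sum_{\ell_i=0}^m\binom{p_i}{\ell_i}(c-1)^{p_i-\ell_i}\right),$$ where the sum is over all integer partitions $p=(p_1,\dots,p_k)$ of $n$ (multisets of positive integers summing to $n$, $k$ arbitrary) and $\#p(i)$ is the number of parts of $p$ equal to $i$.
   Context: $\Pi_n\wr C_c$ is the set of colored set partitions of $[n]$: a set partition of $[n]$ together with an assignment of a color in $\{1,\dots,c\}$ to each element. A colored partition eq-contains $1^a1^a\cdots1^a$ (length $m+1$) iff some block contains at least $m+1$ elements of color $a$; $\Pi_n^{eq}\wr C_c(P_{m+1})$ is the set of those that do not. $\binom{n}{p_1,\dots,p_k}=\frac{n!}{p_1!\cdots p_k!}$. -}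

module Defs where

open import Data.Nat using (ℕ; zero; suc; _+_; _*_; _∸_; _^_; _≤_; _≥_; _≤ᵇ_; _≡ᵇ_)
open import Data.Nat.Properties using (_!≢0)
open import Data.Nat.Combinatorics using (_C_)
open import Data.Nat.Base using (_!)
open import Data.Bool using (Bool; true; false; _∧_; if_then_else_)
open import Data.Fin using (Fin; toℕ)
open import Data.Vec using (Vec; []; _∷_)
open import Data.List using (List; []; _∷_; map; upTo; foldr)
open import Data.Nat.ListAction using (sum)
open import Data.Product using (Σ; _×_)
open import Data.Integer using (+_)
open import Data.Rational using (ℚ; _/_; 1ℚ; 0ℚ) renaming (_*_ to _*ℚ_; _+_ to _+ℚ_)
open import Data.List.Relation.Unary.All using (All)
open import Data.List.Relation.Unary.Linked using (Linked)
open import Relation.Binary.PropositionalEquality using (_≡_)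

-- A set partition of [n] is encoded canonically by its restricted growth
-- string: a vector of block labels (l_0,…,l_{n-1}) where blocks are
-- numbered 0,1,2,… in order of their smallest element; i.e. each label is
-- at most the number of blocks opened so far (label = that number opens a
-- new block).

rgsFrom : ∀ {k} → ℕ → Vec ℕ k → Bool
rgsFrom b [] = true
rgsFrom b (x ∷ xs) =
  (x ≤ᵇ b) ∧ rgsFrom (if x ≡ᵇ b then suc b else b) xs

IsRGS : ∀ {n} → Vec ℕ n → Set
IsRGS ls = rgsFrom 0 ls ≡ true

-- A colored set partition of [n] with colors Fin c (color a ∈ {1..c} is
-- represented by an element of Fin c).
record ColoredPartition (n c : ℕ) : Set where
  constructor colPart
  field
    labels : Vec ℕ n
    isRGS  : IsRGS labels
    colors : Vec (Fin c) n

blockColorCount : ∀ {n c} → Vec ℕ n → Vec (Fin c) n → ℕ → Fin c → ℕ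
blockColorCount [] [] j a = 0
blockColorCount (l ∷ ls) (col ∷ cs) j a =
  (if (l ≡ᵇ j) ∧ (toℕ col ≡ᵇ toℕ a) then 1 else 0) + blockColorCount ls cs j a

allᵇ : (ℕ → Bool) → List ℕ → Bool
allᵇ f [] = true
allᵇ f (x ∷ xs) = f x ∧ allᵇ f xs

-- the colored partition does NOT eq-contain 1^a 1^a ⋯ 1^a (length m+1):
-- every block (labels are < n) has at most m elements of color a
avoidsᵇ : ∀ {n c} → ℕ → Fin c → ColoredPartition n c → Bool
avoidsᵇ {n} m a π =
  allᵇ (λ j → blockColorCount (ColoredPartition.labels π) (ColoredPartition.colors π) j a ≤ᵇ m) (upTo n)

AvoidingPartition : (n c m : ℕ) → Fin c → Set
AvoidingPartition n c m a =
  Σ (ColoredPartition n c) (λ π → avoidsᵇ m a π ≡ true)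

IsIntPartition : ℕ → List ℕ → Set
IsIntPartition n p = All (λ x → 1 ≤ x) p × Linked _≥_ p × sum p ≡ n

mult : List ℕ → ℕ → ℕ
mult [] i = 0
mult (x ∷ xs) i = (if x ≡ᵇ i then 1 else 0) + mult xs i

productℚ : List ℚ → ℚ
productℚ = foldr _*ℚ_ 1ℚ

sumℚ : List ℚ → ℚ
sumℚ = foldr _+ℚ_ 0ℚ

fromℕ : ℕ → ℚ
fromℕ k = + k / 1

inv! : ℕ → ℚ
inv! k = (+ 1 / (k !)) {{k !≢0}}

multinomial : ℕ → List ℕ → ℚ
multinomial n p = fromℕ (n !) *ℚ productℚ (map inv! p)

innerSum : ℕ → ℕ → ℕ → ℕ
innerSum c m p = sum (map (λ ℓ → (p C ℓ) * ((c ∸ 1) ^ (p ∸ ℓ))) (upTo (suc m)))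

term : (n c m : ℕ) → List ℕ → ℚ
term n c m p =
  multinomial n p
  *ℚ productℚ (map (λ i → inv! (mult p i)) (map suc (upTo n)))
  *ℚ productℚ (map (λ pᵢ → fromℕ (innerSum c m pᵢ)) p)

-- An avoiding colored partition of {0,…,n} splits into the block of 0, say with k further
-- elements, and an avoiding colored partition of the other n − k elements (relabel them by
-- shifting block labels down by one).  The block is any set of k + 1 elements colored with
-- at most m occurrences of a, and there are w(k+1) = Σ_{ℓ≤m} C(k+1,ℓ)(c−1)^{k+1−ℓ} such
-- colorings; so the counts satisfy A(n+1) = Σ_k C(n,k) w(k+1) A(n−k).  The right-hand side
-- of the theorem is n! times the coefficient of xⁿ in ∏_s exp (w(s) xˢ / s!), expanded
-- over the multiplicities of the parts of a partition; differentiating this product shows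
-- that it obeys the same recursion.

module Submission where

open import Defs
open import Algebra.Bundles using (CommutativeSemiring; CommutativeRing)
open import Axiom.UniquenessOfIdentityProofs using (module Decidable⇒UIP)
open import Data.Bool as Bool using (Bool; true; false; if_then_else_; _∧_)
import Data.Bool.Properties as Bool
open import Data.Empty using (⊥; ⊥-elim)
open import Data.Fin as Fin using (Fin; toℕ)
import Data.Fin.Properties as Finₚ
import Data.Integer as ℤ
import Data.Integer.Properties as ℤ
open import Data.List as List using (List; []; _∷_; _++_; map; replicate; applyUpTo; concat)
import Data.List.Properties as List
open import Data.List.Membership.Propositional using (_∈_)
open import Data.List.Membership.Propositional.Properties using (∈-concat⁻; ∈-concat⁺; ∈-map⁻; ∈-map⁺; ∈-upTo⁻)
open import Data.List.Membership.Propositional.Properties.WithK using (unique∧set⇒bag)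
open import Data.List.Relation.Binary.BagAndSetEquality using (∼bag⇒↭)
open import Data.List.Relation.Binary.Permutation.Propositional using (_↭_; ↭⇒↭ₛ)
import Data.List.Relation.Binary.Permutation.Propositional.Properties as ↭
open import Data.List.Relation.Unary.All as All using (All; []; _∷_)
import Data.List.Relation.Unary.All.Properties as All
open import Data.List.Relation.Unary.AllPairs using ([]; _∷_)
import Data.List.Relation.Unary.AllPairs.Properties as AllPairs
open import Data.List.Relation.Unary.Any using (here; there)
import Data.List.Relation.Unary.Any.Properties as Any
open import Data.List.Relation.Unary.Linked as Linked using (Linked; []; [-]; _∷_)
open import Data.List.Relation.Unary.Linked.Properties using (Linked⇒All)
open import Data.List.Relation.Unary.Unique.Propositional using (Unique)
import Data.List.Relation.Unary.Unique.Propositional.Properties as Unique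
open import Data.Nat as ℕ using (ℕ; zero; suc; pred; _+_; _*_; _≤_; _<_; _≥_; z≤n; s≤s; _∸_; _!; _^_; _≤ᵇ_; _≡ᵇ_)
open import Data.Nat.Combinatorics using (_C_; nCk≡n!/k![n-k]!; k![n∸k]!∣n!; nCk+nC[k+1]≡[n+1]C[k+1]; k>n⇒nCk≡0)
open import Data.Nat.DivMod using (m/n*n≡m)
open import Data.Nat.Induction using (<-rec)
open import Data.Nat.ListAction using (sum)
import Data.Nat.Properties as ℕ
open import Data.Nat.Tactic.RingSolver using (solve-∀)
open import Data.Product using (Σ; _×_; _,_; proj₁; proj₂; ∃-syntax)
open import Data.Product.Function.Dependent.Propositional using (Σ-↔)
open import Data.Product.Function.NonDependent.Propositional using (_×-↔_)
open import Data.Product.Properties using (Σ-≡,≡→≡)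
open import Data.Rational as ℚ using (ℚ; 0ℚ; 1ℚ; _/_) renaming (_+_ to _+ℚ_; _*_ to _*ℚ_)
import Data.Rational.Properties as ℚ
open import Algebra.Definitions.RawSemiring ℚ.+-*-rawSemiring using () renaming (_^_ to _^ℚ_)
open import Data.Rational.Solver using (module +-*-Solver)
open import Data.List.Relation.Binary.Permutation.Setoid.Properties ℚ.≡-setoid using (foldr-commMonoid)
import Data.Rational.Unnormalised as ℚᵘ
import Data.Rational.Unnormalised.Properties as ℚᵘ
open import Data.Sum using (_⊎_; inj₁; inj₂)
open import Data.Sum.Function.Propositional using (_⊎-↔_)
open import Data.Unit using (tt)
open import Data.Vec as Vec using (Vec; []; _∷_)
import Data.Vec.Properties as Vecₚ
open import Function.Bundles using (_↔_; _⇔_; mk⇔; mk↔ₛ′; Equivalence)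
open import Function.Properties.Inverse using (↔-refl; ↔-sym; ↔-trans)
open import Relation.Binary.PropositionalEquality
  using (_≡_; _≢_; refl; sym; trans; cong; cong₂; subst; module ≡-Reasoning)
open import Relation.Nullary using (Dec; yes; no; ¬_)

open +-*-Solver using (solve; _:+_; _:*_; _:=_; con)

≤ᵇ≡true⇒≤ : ∀ {x y} → (x ≤ᵇ y) ≡ true → x ≤ y
≤ᵇ≡true⇒≤ {x} {y} x≤ᵇy = ℕ.≤ᵇ⇒≤ x y (Equivalence.from Bool.T-≡ x≤ᵇy)

≤⇒≤ᵇ≡true : ∀ {x y} → x ≤ y → (x ≤ᵇ y) ≡ true
≤⇒≤ᵇ≡true x≤y = Equivalence.to Bool.T-≡ (ℕ.≤⇒≤ᵇ x≤y)

>⇒≤ᵇ≡false : ∀ {x y} → y < x → (x ≤ᵇ y) ≡ false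
>⇒≤ᵇ≡false y<x = Bool.¬-not (λ x≤ᵇy → ℕ.<⇒≱ y<x (≤ᵇ≡true⇒≤ x≤ᵇy))

≡ᵇ≡true⇒≡ : ∀ {x y} → (x ≡ᵇ y) ≡ true → x ≡ y
≡ᵇ≡true⇒≡ {x} {y} x≡ᵇy = ℕ.≡ᵇ⇒≡ x y (Equivalence.from Bool.T-≡ x≡ᵇy)

≡ᵇ-refl : ∀ x → (x ≡ᵇ x) ≡ true
≡ᵇ-refl x = Equivalence.to Bool.T-≡ (ℕ.≡⇒≡ᵇ x x refl)

≢⇒≡ᵇ≡false : ∀ {x y} → x ≢ y → (x ≡ᵇ y) ≡ false
≢⇒≡ᵇ≡false x≢y = Bool.¬-not (λ x≡ᵇy → x≢y (≡ᵇ≡true⇒≡ x≡ᵇy))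

fromℕ-toℚᵘ : ∀ k → ℚ.toℚᵘ (fromℕ k) ℚᵘ.≃ ℚᵘ.mkℚᵘ (ℤ.+ k) 0
fromℕ-toℚᵘ k = ℚ.toℚᵘ-fromℚᵘ (ℚᵘ.mkℚᵘ (ℤ.+ k) 0)

fromℕ-homo-+ : ∀ a b → fromℕ (a + b) ≡ fromℕ a +ℚ fromℕ b
fromℕ-homo-+ a b = ℚ.toℚᵘ-injective (ℚᵘ.≃-trans (fromℕ-toℚᵘ (a + b)) (ℚᵘ.≃-sym
  (ℚᵘ.≃-trans (ℚ.toℚᵘ-homo-+ (fromℕ a) (fromℕ b)) (ℚᵘ.≃-trans (ℚᵘ.+-cong (fromℕ-toℚᵘ a) (fromℕ-toℚᵘ b))
    (ℚᵘ.*≡* (cong (ℤ._* ℤ.+ 1)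
      (trans (cong₂ ℤ._+_ (ℤ.*-identityʳ (ℤ.+ a)) (ℤ.*-identityʳ (ℤ.+ b))) (sym (ℤ.pos-+ a b)))))))))

fromℕ-homo-* : ∀ a b → fromℕ (a * b) ≡ fromℕ a *ℚ fromℕ b
fromℕ-homo-* a b = ℚ.toℚᵘ-injective (ℚᵘ.≃-trans (fromℕ-toℚᵘ (a * b)) (ℚᵘ.≃-sym
  (ℚᵘ.≃-trans (ℚ.toℚᵘ-homo-* (fromℕ a) (fromℕ b)) (ℚᵘ.≃-trans (ℚᵘ.*-cong (fromℕ-toℚᵘ a) (fromℕ-toℚᵘ b))
    (ℚᵘ.*≡* (cong (ℤ._* ℤ.+ 1) (sym (ℤ.pos-* a b))))))))

fromℕ*1/≡1 : ∀ d .{{_ : ℕ.NonZero d}} → fromℕ d *ℚ (ℤ.+ 1 / d) ≡ 1ℚ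
fromℕ*1/≡1 (suc d) = ℚ.toℚᵘ-injective (ℚᵘ.≃-trans (ℚ.toℚᵘ-homo-* (fromℕ (suc d)) (ℤ.+ 1 / suc d))
  (ℚᵘ.≃-trans (ℚᵘ.*-cong (fromℕ-toℚᵘ (suc d)) (ℚ.toℚᵘ-fromℚᵘ (ℚᵘ.mkℚᵘ (ℤ.+ 1) d)))
    (ℚᵘ.*≡* (begin
      (ℤ.+ suc d ℤ.* ℤ.+ 1) ℤ.* ℤ.+ 1  ≡⟨ ℤ.*-identityʳ _ ⟩
      ℤ.+ suc d ℤ.* ℤ.+ 1            ≡⟨ ℤ.*-identityʳ _ ⟩
      ℤ.+ suc d                    ≡⟨ ℤ.*-identityˡ _ ⟨
      ℤ.+ 1 ℤ.* ℤ.+ suc d            ≡⟨ cong (λ x → ℤ.+ 1 ℤ.* ℤ.+ suc x) (ℕ.+-identityʳ d) ⟨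
      ℤ.+ 1 ℤ.* ℤ.+ suc (d + 0)    ∎))))
  where open ≡-Reasoning

fromℕ!*inv!≡1 : ∀ t → fromℕ (t !) *ℚ inv! t ≡ 1ℚ
fromℕ!*inv!≡1 t = fromℕ*1/≡1 (t !) {{t ℕ.!≢0}}

fromℕ-suc*inv!-suc : ∀ t → fromℕ (suc t) *ℚ inv! (suc t) ≡ inv! t
fromℕ-suc*inv!-suc t = begin
  fromℕ (suc t) *ℚ inv! (suc t)                                  ≡⟨ ℚ.*-identityʳ _ ⟨
  fromℕ (suc t) *ℚ inv! (suc t) *ℚ 1ℚ
    ≡⟨ cong (fromℕ (suc t) *ℚ inv! (suc t) *ℚ_) (fromℕ!*inv!≡1 t) ⟨
  fromℕ (suc t) *ℚ inv! (suc t) *ℚ (fromℕ (t !) *ℚ inv! t)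
    ≡⟨ solve 4 (λ a b c d → a :* b :* (c :* d) := a :* c :* b :* d) refl (fromℕ (suc t)) (inv! (suc t)) (fromℕ (t !)) (inv! t) ⟩
  fromℕ (suc t) *ℚ fromℕ (t !) *ℚ inv! (suc t) *ℚ inv! t
    ≡⟨ cong (λ z → z *ℚ inv! (suc t) *ℚ inv! t) (fromℕ-homo-* (suc t) (t !)) ⟨
  fromℕ (suc t !) *ℚ inv! (suc t) *ℚ inv! t                      ≡⟨ cong (_*ℚ inv! t) (fromℕ!*inv!≡1 (suc t)) ⟩
  1ℚ *ℚ inv! t                                                    ≡⟨ ℚ.*-identityˡ (inv! t) ⟩
  inv! t ∎
  where open ≡-Reasoning

fromℕ!*inv!≡binomial : ∀ {n i} → i ≤ n → fromℕ (n !) *ℚ inv! i ≡ fromℕ (n C i) *ℚ fromℕ ((n ∸ i) !)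
fromℕ!*inv!≡binomial {n} {i} i≤n = begin
  fromℕ (n !) *ℚ inv! i                                          ≡⟨ cong (λ z → fromℕ z *ℚ inv! i) n!≡ ⟨
  fromℕ ((n C i) * (i ! * (n ∸ i) !)) *ℚ inv! i
    ≡⟨ cong (_*ℚ inv! i) (trans (fromℕ-homo-* (n C i) _) (cong (fromℕ (n C i) *ℚ_) (fromℕ-homo-* (i !) ((n ∸ i) !)))) ⟩
  fromℕ (n C i) *ℚ (fromℕ (i !) *ℚ fromℕ ((n ∸ i) !)) *ℚ inv! i
    ≡⟨ solve 4 (λ a b c d → a :* (b :* c) :* d := a :* c :* (b :* d)) refl
               (fromℕ (n C i)) (fromℕ (i !)) (fromℕ ((n ∸ i) !)) (inv! i) ⟩
  fromℕ (n C i) *ℚ fromℕ ((n ∸ i) !) *ℚ (fromℕ (i !) *ℚ inv! i)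
    ≡⟨ cong (fromℕ (n C i) *ℚ fromℕ ((n ∸ i) !) *ℚ_) (fromℕ!*inv!≡1 i) ⟩
  fromℕ (n C i) *ℚ fromℕ ((n ∸ i) !) *ℚ 1ℚ                       ≡⟨ ℚ.*-identityʳ _ ⟩
  fromℕ (n C i) *ℚ fromℕ ((n ∸ i) !) ∎
  where
  open ≡-Reasoning
  n!≡ : (n C i) * (i ! * (n ∸ i) !) ≡ n !
  n!≡ = trans (cong (_* (i ! * (n ∸ i) !)) (nCk≡n!/k![n-k]! i≤n))
              (m/n*n≡m {{i ℕ.!* (n ∸ i) !≢0}} (k![n∸k]!∣n! i≤n))

module RangeSum {c ℓ} (R : CommutativeSemiring c ℓ) where

  open CommutativeSemiring R renaming (_+_ to _⊕_; _*_ to _⊗_; refl to ≈-refl; sym to ≈-sym; trans to ≈-trans)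
  open import Algebra.Properties.CommutativeSemigroup +-commutativeSemigroup using (interchange)

  ∑< : ℕ → (ℕ → Carrier) → Carrier
  ∑< zero    f = 0#
  ∑< (suc k) f = f 0 ⊕ ∑< k (λ i → f (suc i))

  ∑<-cong : ∀ k {f g : ℕ → Carrier} → (∀ i → i < k → f i ≈ g i) → ∑< k f ≈ ∑< k g
  ∑<-cong zero    f≈g = ≈-refl
  ∑<-cong (suc k) f≈g = +-cong (f≈g 0 (s≤s z≤n)) (∑<-cong k (λ i i<k → f≈g (suc i) (s≤s i<k)))

  ∑<-zero : ∀ k {f : ℕ → Carrier} → (∀ i → i < k → f i ≈ 0#) → ∑< k f ≈ 0#
  ∑<-zero zero    f≈0 = ≈-refl
  ∑<-zero (suc k) f≈0 = ≈-trans (+-cong (f≈0 0 (s≤s z≤n)) (∑<-zero k (λ i i<k → f≈0 (suc i) (s≤s i<k)))) (+-identityˡ 0#)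

  ∑<-distrib-+ : ∀ k (f g : ℕ → Carrier) → ∑< k (λ i → f i ⊕ g i) ≈ ∑< k f ⊕ ∑< k g
  ∑<-distrib-+ zero    f g = ≈-sym (+-identityˡ 0#)
  ∑<-distrib-+ (suc k) f g = ≈-trans (+-congˡ (∑<-distrib-+ k _ _)) (interchange _ _ _ _)

  *-distribˡ-∑< : ∀ k x (f : ℕ → Carrier) → x ⊗ ∑< k f ≈ ∑< k (λ i → x ⊗ f i)
  *-distribˡ-∑< zero    x f = zeroʳ x
  *-distribˡ-∑< (suc k) x f = ≈-trans (distribˡ x _ _) (+-congˡ (*-distribˡ-∑< k x _))

  ∑<-comm : ∀ a b (f : ℕ → ℕ → Carrier) → ∑< a (λ t → ∑< b (f t)) ≈ ∑< b (λ i → ∑< a (λ t → f t i))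
  ∑<-comm zero    b f = ≈-sym (∑<-zero b (λ _ _ → ≈-refl))
  ∑<-comm (suc a) b f = ≈-trans (+-congˡ (∑<-comm a b _)) (≈-sym (∑<-distrib-+ b _ _))

  ∑<-snoc : ∀ k (f : ℕ → Carrier) → ∑< (suc k) f ≈ ∑< k f ⊕ f k
  ∑<-snoc zero    f = ≈-trans (+-identityʳ (f 0)) (≈-sym (+-identityˡ (f 0)))
  ∑<-snoc (suc k) f = ≈-trans (+-congˡ (∑<-snoc k _)) (≈-sym (+-assoc _ _ _))

  ∑<-truncate : ∀ k l (f : ℕ → Carrier) → k ≤ l → (∀ t → k ≤ t → t < l → f t ≈ 0#) → ∑< l f ≈ ∑< k f
  ∑<-truncate zero    l       f _         f≈0 = ∑<-zero l (λ t → f≈0 t z≤n)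
  ∑<-truncate (suc k) (suc l) f (s≤s k≤l) f≈0 =
    +-congˡ (∑<-truncate k l (λ t → f (suc t)) k≤l (λ t k≤t t<l → f≈0 (suc t) (s≤s k≤t) (s≤s t<l)))

module ∑ℕ = RangeSum ℕ.+-*-commutativeSemiring
module ∑ℚ = RangeSum (CommutativeRing.commutativeSemiring ℚ.+-*-commutativeRing)

sum-map-applyUpTo : ∀ k (f g : ℕ → ℕ) → sum (List.map f (applyUpTo g k)) ≡ ∑ℕ.∑< k (λ i → f (g i))
sum-map-applyUpTo zero    f g = refl
sum-map-applyUpTo (suc k) f g = cong (f (g 0) +_) (sum-map-applyUpTo k f (λ i → g (suc i)))

sum-map-upTo : ∀ k (f : ℕ → ℕ) → sum (List.map f (List.upTo k)) ≡ ∑ℕ.∑< k f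
sum-map-upTo k f = sum-map-applyUpTo k f (λ i → i)

fromℕ-∑< : ∀ k (f : ℕ → ℕ) → fromℕ (∑ℕ.∑< k f) ≡ ∑ℚ.∑< k (λ i → fromℕ (f i))
fromℕ-∑< zero    f = refl
fromℕ-∑< (suc k) f = trans (fromℕ-homo-+ (f 0) _) (cong (fromℕ (f 0) +ℚ_) (fromℕ-∑< k (λ i → f (suc i))))

open ∑ℚ using (∑<)

sumℚ-++ : ∀ (xs ys : List ℚ) → sumℚ (xs ++ ys) ≡ sumℚ xs +ℚ sumℚ ys
sumℚ-++ []       ys = sym (ℚ.+-identityˡ (sumℚ ys))
sumℚ-++ (x ∷ xs) ys = trans (cong (x +ℚ_) (sumℚ-++ xs ys)) (sym (ℚ.+-assoc x (sumℚ xs) (sumℚ ys)))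

productℚ-++ : ∀ (xs ys : List ℚ) → productℚ (xs ++ ys) ≡ productℚ xs *ℚ productℚ ys
productℚ-++ []       ys = sym (ℚ.*-identityˡ (productℚ ys))
productℚ-++ (x ∷ xs) ys = trans (cong (x *ℚ_) (productℚ-++ xs ys)) (sym (ℚ.*-assoc x (productℚ xs) (productℚ ys)))

module _ {A : Set} where

  sumℚ-map-cong : ∀ {f g : A → ℚ} xs → (∀ {x} → x ∈ xs → f x ≡ g x) → sumℚ (List.map f xs) ≡ sumℚ (List.map g xs)
  sumℚ-map-cong []       f≡g = refl
  sumℚ-map-cong (x ∷ xs) f≡g = cong₂ _+ℚ_ (f≡g (here refl)) (sumℚ-map-cong xs (λ x∈ → f≡g (there x∈)))

  productℚ-map-cong : ∀ {f g : A → ℚ} xs → (∀ {x} → x ∈ xs → f x ≡ g x) →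
                      productℚ (List.map f xs) ≡ productℚ (List.map g xs)
  productℚ-map-cong []       f≡g = refl
  productℚ-map-cong (x ∷ xs) f≡g = cong₂ _*ℚ_ (f≡g (here refl)) (productℚ-map-cong xs (λ x∈ → f≡g (there x∈)))

  sumℚ-map-*ˡ : ∀ c (f : A → ℚ) xs → sumℚ (List.map (λ x → c *ℚ f x) xs) ≡ c *ℚ sumℚ (List.map f xs)
  sumℚ-map-*ˡ c f []       = sym (ℚ.*-zeroʳ c)
  sumℚ-map-*ˡ c f (x ∷ xs) = trans (cong (c *ℚ f x +ℚ_) (sumℚ-map-*ˡ c f xs)) (sym (ℚ.*-distribˡ-+ c (f x) _))

  productℚ-map-* : ∀ (f g : A → ℚ) xs →
    productℚ (List.map (λ x → f x *ℚ g x) xs) ≡ productℚ (List.map f xs) *ℚ productℚ (List.map g xs)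
  productℚ-map-* f g []       = refl
  productℚ-map-* f g (x ∷ xs) = trans (cong (f x *ℚ g x *ℚ_) (productℚ-map-* f g xs))
    (solve 4 (λ a b c d → a :* b :* (c :* d) := a :* c :* (b :* d)) refl (f x) (g x) (productℚ (List.map f xs)) (productℚ (List.map g xs)))

  sumℚ-concat-applyUpTo : ∀ k (f : A → ℚ) (g : ℕ → List A) →
    sumℚ (List.map f (concat (applyUpTo g k))) ≡ ∑< k (λ t → sumℚ (List.map f (g t)))
  sumℚ-concat-applyUpTo zero    f g = refl
  sumℚ-concat-applyUpTo (suc k) f g = begin
    sumℚ (List.map f (g 0 ++ concat (applyUpTo (λ t → g (suc t)) k)))
      ≡⟨ cong sumℚ (List.map-++ f (g 0) _) ⟩
    sumℚ (List.map f (g 0) ++ List.map f (concat (applyUpTo (λ t → g (suc t)) k)))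
      ≡⟨ sumℚ-++ (List.map f (g 0)) _ ⟩
    sumℚ (List.map f (g 0)) +ℚ sumℚ (List.map f (concat (applyUpTo (λ t → g (suc t)) k)))
      ≡⟨ cong (sumℚ (List.map f (g 0)) +ℚ_) (sumℚ-concat-applyUpTo k f (λ t → g (suc t))) ⟩
    ∑< (suc k) (λ t → sumℚ (List.map f (g t))) ∎
    where open ≡-Reasoning

  sumℚ-map-↭ : ∀ (f : A → ℚ) {xs ys} → xs ↭ ys → sumℚ (List.map f xs) ≡ sumℚ (List.map f ys)
  sumℚ-map-↭ f xs↭ys = foldr-commMonoid ℚ.+-0-isCommutativeMonoid (↭⇒↭ₛ (↭.map⁺ f xs↭ys))

⟦_≤_⟧ : ℕ → ℕ → ℚ
⟦ a ≤ b ⟧ = if a ≤ᵇ b then 1ℚ else 0ℚ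

⟦≤⟧-yes : ∀ {a b} → a ≤ b → ⟦ a ≤ b ⟧ ≡ 1ℚ
⟦≤⟧-yes a≤b = cong (λ β → if β then 1ℚ else 0ℚ) (≤⇒≤ᵇ≡true a≤b)

⟦≤⟧-no : ∀ {a b} → b < a → ⟦ a ≤ b ⟧ ≡ 0ℚ
⟦≤⟧-no b<a = cong (λ β → if β then 1ℚ else 0ℚ) (>⇒≤ᵇ≡false b<a)

⟦≤⟧*-yes : ∀ {a b} x → a ≤ b → ⟦ a ≤ b ⟧ *ℚ x ≡ x
⟦≤⟧*-yes x a≤b = trans (cong (_*ℚ x) (⟦≤⟧-yes a≤b)) (ℚ.*-identityˡ x)

⟦≤⟧*-no : ∀ {a b} x → b < a → ⟦ a ≤ b ⟧ *ℚ x ≡ 0ℚ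
⟦≤⟧*-no x b<a = trans (cong (_*ℚ x) (⟦≤⟧-no b<a)) (ℚ.*-zeroˡ x)

⟦≤⟧*-congʳ : ∀ a b {x y} → (a ≤ b → x ≡ y) → ⟦ a ≤ b ⟧ *ℚ x ≡ ⟦ a ≤ b ⟧ *ℚ y
⟦≤⟧*-congʳ a b {x} {y} x≡y with a ℕ.≤? b
... | yes a≤b = cong (⟦ a ≤ b ⟧ *ℚ_) (x≡y a≤b)
... | no  a≰b = trans (⟦≤⟧*-no x (ℕ.≰⇒> a≰b)) (sym (⟦≤⟧*-no y (ℕ.≰⇒> a≰b)))

⟦+≤⟧ : ∀ a x n → ⟦ a + x ≤ n ⟧ ≡ ⟦ a ≤ n ⟧ *ℚ ⟦ x ≤ n ∸ a ⟧
⟦+≤⟧ a x n with a ℕ.≤? n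
... | no a≰n = trans (⟦≤⟧-no (ℕ.<-≤-trans (ℕ.≰⇒> a≰n) (ℕ.m≤m+n a x)))
                     (sym (⟦≤⟧*-no ⟦ x ≤ n ∸ a ⟧ (ℕ.≰⇒> a≰n)))
... | yes a≤n with x ℕ.≤? n ∸ a
...   | yes x≤n∸a = trans (⟦≤⟧-yes (subst (_≤ n) (ℕ.+-comm x a) (ℕ.m≤o∸n⇒m+n≤o x a≤n x≤n∸a)))
                          (sym (trans (⟦≤⟧*-yes ⟦ x ≤ n ∸ a ⟧ a≤n) (⟦≤⟧-yes x≤n∸a)))
...   | no  x≰n∸a = trans (⟦≤⟧-no (ℕ.≰⇒> λ a+x≤n → x≰n∸a (ℕ.m+n≤o⇒m≤o∸n x (subst (_≤ n) (ℕ.+-comm a x) a+x≤n))))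
                          (sym (trans (⟦≤⟧*-yes ⟦ x ≤ n ∸ a ⟧ a≤n) (⟦≤⟧-no (ℕ.≰⇒> x≰n∸a))))

∑multiples : ℕ → ℕ → ℕ → (ℕ → ℕ → ℚ) → ℚ
∑multiples s k n F = ∑< k (λ t → ⟦ t * s ≤ n ⟧ *ℚ F t (n ∸ t * s))

∑multiples-range : ∀ j k n F → suc n ≤ k → ∑multiples (suc j) k n F ≡ ∑multiples (suc j) (suc n) n F
∑multiples-range j k n F n<k = ∑ℚ.∑<-truncate (suc n) k (λ t → ⟦ t * suc j ≤ n ⟧ *ℚ F t (n ∸ t * suc j)) n<k
  (λ t n<t _ → ⟦≤⟧*-no (F t (n ∸ t * suc j)) (ℕ.<-≤-trans n<t (ℕ.m≤m*n t (suc j))))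

∑multiples-guard : ∀ s k n a F →
  ∑multiples s k n (λ t r → ⟦ a ≤ r ⟧ *ℚ F t (r ∸ a)) ≡ ⟦ a ≤ n ⟧ *ℚ ∑multiples s k (n ∸ a) F
∑multiples-guard s k n a F = trans (∑ℚ.∑<-cong k (λ t _ → guards-commute (t * s) (F t)))
                                   (sym (∑ℚ.*-distribˡ-∑< k ⟦ a ≤ n ⟧ (λ t → ⟦ t * s ≤ n ∸ a ⟧ *ℚ F t (n ∸ a ∸ t * s))))
  where
  guards-commute : ∀ x (f : ℕ → ℚ) →
    ⟦ x ≤ n ⟧ *ℚ (⟦ a ≤ n ∸ x ⟧ *ℚ f (n ∸ x ∸ a)) ≡ ⟦ a ≤ n ⟧ *ℚ (⟦ x ≤ n ∸ a ⟧ *ℚ f (n ∸ a ∸ x))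
  guards-commute x f = begin
    ⟦ x ≤ n ⟧ *ℚ (⟦ a ≤ n ∸ x ⟧ *ℚ f (n ∸ x ∸ a))
      ≡⟨ ℚ.*-assoc ⟦ x ≤ n ⟧ ⟦ a ≤ n ∸ x ⟧ (f (n ∸ x ∸ a)) ⟨
    ⟦ x ≤ n ⟧ *ℚ ⟦ a ≤ n ∸ x ⟧ *ℚ f (n ∸ x ∸ a)    ≡⟨ cong (_*ℚ f (n ∸ x ∸ a)) (⟦+≤⟧ x a n) ⟨
    ⟦ x + a ≤ n ⟧ *ℚ f (n ∸ x ∸ a)               ≡⟨ cong₂ (λ y z → ⟦ y ≤ n ⟧ *ℚ f z) (ℕ.+-comm x a) ∸-comm ⟩
    ⟦ a + x ≤ n ⟧ *ℚ f (n ∸ a ∸ x)               ≡⟨ cong (_*ℚ f (n ∸ a ∸ x)) (⟦+≤⟧ a x n) ⟩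
    ⟦ a ≤ n ⟧ *ℚ ⟦ x ≤ n ∸ a ⟧ *ℚ f (n ∸ a ∸ x)
      ≡⟨ ℚ.*-assoc ⟦ a ≤ n ⟧ ⟦ x ≤ n ∸ a ⟧ (f (n ∸ a ∸ x)) ⟩
    ⟦ a ≤ n ⟧ *ℚ (⟦ x ≤ n ∸ a ⟧ *ℚ f (n ∸ a ∸ x))  ∎
    where
    open ≡-Reasoning
    ∸-comm : n ∸ x ∸ a ≡ n ∸ a ∸ x
    ∸-comm = trans (ℕ.∸-+-assoc n x a) (trans (cong (n ∸_) (ℕ.+-comm x a)) (sym (ℕ.∸-+-assoc n a x)))

∑multiples-suc : ∀ s k n F →
  ∑multiples s (suc k) n F ≡ F 0 n +ℚ ⟦ s ≤ n ⟧ *ℚ ∑multiples s k (n ∸ s) (λ t → F (suc t))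
∑multiples-suc s k n F = cong₂ _+ℚ_ (ℚ.*-identityˡ (F 0 n))
  (trans (∑ℚ.∑<-cong k (λ t _ → split-guard (t * s) (F (suc t))))
         (sym (∑ℚ.*-distribˡ-∑< k ⟦ s ≤ n ⟧ (λ t → ⟦ t * s ≤ n ∸ s ⟧ *ℚ F (suc t) (n ∸ s ∸ t * s)))))
  where
  split-guard : ∀ x (f : ℕ → ℚ) →
    ⟦ s + x ≤ n ⟧ *ℚ f (n ∸ (s + x)) ≡ ⟦ s ≤ n ⟧ *ℚ (⟦ x ≤ n ∸ s ⟧ *ℚ f (n ∸ s ∸ x))
  split-guard x f = trans (cong₂ _*ℚ_ (⟦+≤⟧ s x n) (cong f (sym (ℕ.∸-+-assoc n s x))))
                          (ℚ.*-assoc ⟦ s ≤ n ⟧ ⟦ x ≤ n ∸ s ⟧ (f (n ∸ s ∸ x)))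

∑multiples-cong : ∀ s k n {F F′ : ℕ → ℕ → ℚ} → (∀ t r → F t r ≡ F′ t r) → ∑multiples s k n F ≡ ∑multiples s k n F′
∑multiples-cong s k n F≡F′ = ∑ℚ.∑<-cong k (λ t _ → cong (⟦ t * s ≤ n ⟧ *ℚ_) (F≡F′ t (n ∸ t * s)))

∑multiples-*ˡ : ∀ s k n c F → ∑multiples s k n (λ t r → c *ℚ F t r) ≡ c *ℚ ∑multiples s k n F
∑multiples-*ˡ s k n c F = trans
  (∑ℚ.∑<-cong k (λ t _ → solve 3 (λ g c f → g :* (c :* f) := c :* (g :* f)) refl ⟦ t * s ≤ n ⟧ c (F t (n ∸ t * s))))
  (sym (∑ℚ.*-distribˡ-∑< k c (λ t → ⟦ t * s ≤ n ⟧ *ℚ F t (n ∸ t * s))))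

-- The Leibniz rule for the Euler operator xⁿ ↦ n xⁿ, with n = (n − ts) + ts.
∑multiples-leibniz : ∀ s k n F →
  fromℕ n *ℚ ∑multiples s k n F ≡
  ∑multiples s k n (λ t r → fromℕ r *ℚ F t r) +ℚ ∑multiples s k n (λ t r → fromℕ (t * s) *ℚ F t r)
∑multiples-leibniz s k n F = begin
  fromℕ n *ℚ ∑multiples s k n F
    ≡⟨ ∑ℚ.*-distribˡ-∑< k (fromℕ n) (λ t → ⟦ t * s ≤ n ⟧ *ℚ F t (n ∸ t * s)) ⟩
  ∑< k (λ t → fromℕ n *ℚ (⟦ t * s ≤ n ⟧ *ℚ F t (n ∸ t * s)))
    ≡⟨ ∑ℚ.∑<-cong k (λ t _ → split-term (t * s) (F t)) ⟩
  ∑< k (λ t → ⟦ t * s ≤ n ⟧ *ℚ (fromℕ (n ∸ t * s) *ℚ F t (n ∸ t * s))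
           +ℚ ⟦ t * s ≤ n ⟧ *ℚ (fromℕ (t * s) *ℚ F t (n ∸ t * s)))
    ≡⟨ ∑ℚ.∑<-distrib-+ k _ _ ⟩
  ∑multiples s k n (λ t r → fromℕ r *ℚ F t r) +ℚ ∑multiples s k n (λ t r → fromℕ (t * s) *ℚ F t r) ∎
  where
  open ≡-Reasoning
  split-term : ∀ x (f : ℕ → ℚ) →
    fromℕ n *ℚ (⟦ x ≤ n ⟧ *ℚ f (n ∸ x)) ≡
    ⟦ x ≤ n ⟧ *ℚ (fromℕ (n ∸ x) *ℚ f (n ∸ x)) +ℚ ⟦ x ≤ n ⟧ *ℚ (fromℕ x *ℚ f (n ∸ x))
  split-term x f = begin
    fromℕ n *ℚ (⟦ x ≤ n ⟧ *ℚ f (n ∸ x))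
      ≡⟨ solve 3 (λ a g b → a :* (g :* b) := g :* (a :* b)) refl (fromℕ n) ⟦ x ≤ n ⟧ (f (n ∸ x)) ⟩
    ⟦ x ≤ n ⟧ *ℚ (fromℕ n *ℚ f (n ∸ x))
      ≡⟨ ⟦≤⟧*-congʳ x n (λ x≤n → trans (cong (λ m → fromℕ m *ℚ f (n ∸ x)) (sym (ℕ.m∸n+n≡m x≤n)))
                                  (trans (cong (_*ℚ f (n ∸ x)) (fromℕ-homo-+ (n ∸ x) x))
                                         (ℚ.*-distribʳ-+ (f (n ∸ x)) (fromℕ (n ∸ x)) (fromℕ x)))) ⟩
    ⟦ x ≤ n ⟧ *ℚ (fromℕ (n ∸ x) *ℚ f (n ∸ x) +ℚ fromℕ x *ℚ f (n ∸ x))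
      ≡⟨ ℚ.*-distribˡ-+ ⟦ x ≤ n ⟧ (fromℕ (n ∸ x) *ℚ f (n ∸ x)) (fromℕ x *ℚ f (n ∸ x)) ⟩
    ⟦ x ≤ n ⟧ *ℚ (fromℕ (n ∸ x) *ℚ f (n ∸ x)) +ℚ ⟦ x ≤ n ⟧ *ℚ (fromℕ x *ℚ f (n ∸ x)) ∎

-- The exponential formula

module ExponentialFormula (w : ℕ → ℚ) where

  u : ℕ → ℚ
  u i = w i *ℚ inv! i

  K : ℕ → ℚ
  K i = fromℕ i *ℚ u i

  expTerm : ℕ → ℕ → ℚ
  expTerm s t = u s ^ℚ t *ℚ inv! t

  -- G n j is the coefficient of xⁿ in exp (u 1 x¹) ⋯ exp (u j xʲ).
  G : ℕ → ℕ → ℚ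
  G n       (suc j) = ∑multiples (suc j) (suc n) n (λ t r → expTerm (suc j) t *ℚ G r j)
  G zero    zero    = 1ℚ
  G (suc n) zero    = 0ℚ

  expTerm-suc : ∀ s t → fromℕ (suc t) *ℚ expTerm s (suc t) ≡ u s *ℚ expTerm s t
  expTerm-suc s t = begin
    fromℕ (suc t) *ℚ (u s *ℚ u s ^ℚ t *ℚ inv! (suc t))
      ≡⟨ solve 4 (λ a b c d → a :* (b :* c :* d) := b :* c :* (a :* d)) refl (fromℕ (suc t)) (u s) (u s ^ℚ t) (inv! (suc t)) ⟩
    u s *ℚ u s ^ℚ t *ℚ (fromℕ (suc t) *ℚ inv! (suc t))  ≡⟨ cong (u s *ℚ u s ^ℚ t *ℚ_) (fromℕ-suc*inv!-suc t) ⟩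
    u s *ℚ u s ^ℚ t *ℚ inv! t                             ≡⟨ ℚ.*-assoc (u s) (u s ^ℚ t) (inv! t) ⟩
    u s *ℚ expTerm s t ∎
    where open ≡-Reasoning

  K*expTerm : ∀ s t g → fromℕ (suc t * s) *ℚ (expTerm s (suc t) *ℚ g) ≡ K s *ℚ (expTerm s t *ℚ g)
  K*expTerm s t g = begin
    fromℕ (suc t * s) *ℚ (expTerm s (suc t) *ℚ g)
      ≡⟨ cong (_*ℚ (expTerm s (suc t) *ℚ g)) (trans (cong fromℕ (ℕ.*-comm (suc t) s)) (fromℕ-homo-* s (suc t))) ⟩
    fromℕ s *ℚ fromℕ (suc t) *ℚ (expTerm s (suc t) *ℚ g)
      ≡⟨ solve 4 (λ a b c d → a :* b :* (c :* d) := a :* (b :* c) :* d) refl (fromℕ s) (fromℕ (suc t)) (expTerm s (suc t)) g ⟩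
    fromℕ s *ℚ (fromℕ (suc t) *ℚ expTerm s (suc t)) *ℚ g  ≡⟨ cong (λ z → fromℕ s *ℚ z *ℚ g) (expTerm-suc s t) ⟩
    fromℕ s *ℚ (u s *ℚ expTerm s t) *ℚ g
      ≡⟨ solve 4 (λ a b c d → a :* (b :* c) :* d := a :* b :* (c :* d)) refl (fromℕ s) (u s) (expTerm s t) g ⟩
    K s *ℚ (expTerm s t *ℚ g) ∎
    where open ≡-Reasoning

  ∑KG : ℕ → ℕ → ℚ
  ∑KG j n = ∑< j (λ i → ⟦ suc i ≤ n ⟧ *ℚ (K (suc i) *ℚ G (n ∸ suc i) j))

  -- x (exp (u s xˢ))′ = s u s xˢ exp (u s xˢ), multiplied by the other factors of G.
  euler-new-factor : ∀ j n →
    ∑multiples (suc j) (suc n) n (λ t r → fromℕ (t * suc j) *ℚ (expTerm (suc j) t *ℚ G r j))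
      ≡ ⟦ suc j ≤ n ⟧ *ℚ (K (suc j) *ℚ G (n ∸ suc j) (suc j))
  euler-new-factor j n = begin
    ∑multiples s (suc n) n (λ t r → fromℕ (t * s) *ℚ (expTerm s t *ℚ G r j))
      ≡⟨ ∑multiples-suc s n n (λ t r → fromℕ (t * s) *ℚ (expTerm s t *ℚ G r j)) ⟩
    0ℚ *ℚ (expTerm s 0 *ℚ G n j)
      +ℚ ⟦ s ≤ n ⟧ *ℚ ∑multiples s n (n ∸ s) (λ t r → fromℕ (suc t * s) *ℚ (expTerm s (suc t) *ℚ G r j))
      ≡⟨ cong₂ _+ℚ_ (ℚ.*-zeroˡ (expTerm s 0 *ℚ G n j)) (⟦≤⟧*-congʳ s n (λ s≤n →
           trans (∑multiples-cong s n (n ∸ s) (λ t r → K*expTerm s t (G r j)))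
           (trans (∑multiples-range j n (n ∸ s) (λ t r → K s *ℚ (expTerm s t *ℚ G r j)) (ℕ.∸-monoʳ-< (s≤s z≤n) s≤n))
                  (∑multiples-*ˡ s (suc (n ∸ s)) (n ∸ s) (K s) (λ t r → expTerm s t *ℚ G r j))))) ⟩
    0ℚ +ℚ ⟦ s ≤ n ⟧ *ℚ (K s *ℚ G (n ∸ s) s)  ≡⟨ ℚ.+-identityˡ (⟦ s ≤ n ⟧ *ℚ (K s *ℚ G (n ∸ s) s)) ⟩
    ⟦ s ≤ n ⟧ *ℚ (K s *ℚ G (n ∸ s) s) ∎
    where
    open ≡-Reasoning
    s = suc j

  euler-old-factors : ∀ j n → (∀ r → fromℕ r *ℚ G r j ≡ ∑KG j r) →
    ∑multiples (suc j) (suc n) n (λ t r → fromℕ r *ℚ (expTerm (suc j) t *ℚ G r j))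
      ≡ ∑< j (λ i → ⟦ suc i ≤ n ⟧ *ℚ (K (suc i) *ℚ G (n ∸ suc i) (suc j)))
  euler-old-factors j n euler-G = begin
    ∑multiples s (suc n) n (λ t r → fromℕ r *ℚ (expTerm s t *ℚ G r j))
      ≡⟨ ∑multiples-cong s (suc n) n expand ⟩
    ∑< (suc n) (λ t → ⟦ t * s ≤ n ⟧ *ℚ ∑< j (λ i → ⟦ suc i ≤ n ∸ t * s ⟧ *ℚ H i t (n ∸ t * s ∸ suc i)))
      ≡⟨ ∑ℚ.∑<-cong (suc n) (λ t _ → ∑ℚ.*-distribˡ-∑< j ⟦ t * s ≤ n ⟧
                                        (λ i → ⟦ suc i ≤ n ∸ t * s ⟧ *ℚ H i t (n ∸ t * s ∸ suc i))) ⟩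
    ∑< (suc n) (λ t → ∑< j (λ i → ⟦ t * s ≤ n ⟧ *ℚ (⟦ suc i ≤ n ∸ t * s ⟧ *ℚ H i t (n ∸ t * s ∸ suc i))))
      ≡⟨ ∑ℚ.∑<-comm (suc n) j (λ t i → ⟦ t * s ≤ n ⟧ *ℚ (⟦ suc i ≤ n ∸ t * s ⟧ *ℚ H i t (n ∸ t * s ∸ suc i))) ⟩
    ∑< j (λ i → ∑multiples s (suc n) n (λ t r → ⟦ suc i ≤ r ⟧ *ℚ H i t (r ∸ suc i)))
      ≡⟨ ∑ℚ.∑<-cong j (λ i _ → ∑multiples-guard s (suc n) n (suc i) (H i)) ⟩
    ∑< j (λ i → ⟦ suc i ≤ n ⟧ *ℚ ∑multiples s (suc n) (n ∸ suc i) (H i))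
      ≡⟨ ∑ℚ.∑<-cong j (λ i _ → cong (⟦ suc i ≤ n ⟧ *ℚ_)
           (trans (∑multiples-range j (suc n) (n ∸ suc i) (H i) (s≤s (ℕ.m∸n≤m n (suc i))))
                  (∑multiples-*ˡ s (suc (n ∸ suc i)) (n ∸ suc i) (K (suc i)) (λ t r → expTerm s t *ℚ G r j)))) ⟩
    ∑< j (λ i → ⟦ suc i ≤ n ⟧ *ℚ (K (suc i) *ℚ G (n ∸ suc i) s)) ∎
    where
    open ≡-Reasoning
    s = suc j
    H : ℕ → ℕ → ℕ → ℚ
    H i t r = K (suc i) *ℚ (expTerm s t *ℚ G r j)
    expand : ∀ t r → fromℕ r *ℚ (expTerm s t *ℚ G r j) ≡ ∑< j (λ i → ⟦ suc i ≤ r ⟧ *ℚ H i t (r ∸ suc i))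
    expand t r = begin
      fromℕ r *ℚ (expTerm s t *ℚ G r j)
        ≡⟨ solve 3 (λ a e g → a :* (e :* g) := e :* (a :* g)) refl (fromℕ r) (expTerm s t) (G r j) ⟩
      expTerm s t *ℚ (fromℕ r *ℚ G r j)  ≡⟨ cong (expTerm s t *ℚ_) (euler-G r) ⟩
      expTerm s t *ℚ ∑KG j r
        ≡⟨ ∑ℚ.*-distribˡ-∑< j (expTerm s t) (λ i → ⟦ suc i ≤ r ⟧ *ℚ (K (suc i) *ℚ G (r ∸ suc i) j)) ⟩
      ∑< j (λ i → expTerm s t *ℚ (⟦ suc i ≤ r ⟧ *ℚ (K (suc i) *ℚ G (r ∸ suc i) j)))
        ≡⟨ ∑ℚ.∑<-cong j (λ i _ → solve 4 (λ e g k h → e :* (g :* (k :* h)) := g :* (k :* (e :* h))) refl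
                                   (expTerm s t) ⟦ suc i ≤ r ⟧ (K (suc i)) (G (r ∸ suc i) j)) ⟩
      ∑< j (λ i → ⟦ suc i ≤ r ⟧ *ℚ H i t (r ∸ suc i)) ∎

  -- The coefficients of x G′ = (Σ_{s ≤ j} s u s xˢ) G.
  G-derivative : ∀ j n → fromℕ n *ℚ G n j ≡ ∑KG j n
  G-derivative zero    zero    = ℚ.*-zeroˡ 1ℚ
  G-derivative zero    (suc n) = ℚ.*-zeroʳ (fromℕ (suc n))
  G-derivative (suc j) n = begin
    fromℕ n *ℚ G n (suc j)
      ≡⟨ ∑multiples-leibniz (suc j) (suc n) n (λ t r → expTerm (suc j) t *ℚ G r j) ⟩
    ∑multiples (suc j) (suc n) n (λ t r → fromℕ r *ℚ (expTerm (suc j) t *ℚ G r j))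
      +ℚ ∑multiples (suc j) (suc n) n (λ t r → fromℕ (t * suc j) *ℚ (expTerm (suc j) t *ℚ G r j))
      ≡⟨ cong₂ _+ℚ_ (euler-old-factors j n (G-derivative j)) (euler-new-factor j n) ⟩
    ∑< j summand +ℚ summand j  ≡⟨ ∑ℚ.∑<-snoc j summand ⟨
    ∑KG (suc j) n ∎
    where
    open ≡-Reasoning
    summand : ℕ → ℚ
    summand i = ⟦ suc i ≤ n ⟧ *ℚ (K (suc i) *ℚ G (n ∸ suc i) (suc j))

  G-stable : ∀ n j → n ≤ j → G n (suc j) ≡ G n j
  G-stable n j n≤j = begin
    G n (suc j)
      ≡⟨ ∑multiples-suc (suc j) n n (λ t r → expTerm (suc j) t *ℚ G r j) ⟩
    1ℚ *ℚ G n j +ℚ ⟦ suc j ≤ n ⟧ *ℚ ∑multiples (suc j) n (n ∸ suc j) (λ t r → expTerm (suc j) (suc t) *ℚ G r j)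
      ≡⟨ cong₂ _+ℚ_ (ℚ.*-identityˡ (G n j))
                    (⟦≤⟧*-no (∑multiples (suc j) n (n ∸ suc j) (λ t r → expTerm (suc j) (suc t) *ℚ G r j)) (s≤s n≤j)) ⟩
    G n j +ℚ 0ℚ  ≡⟨ ℚ.+-identityʳ (G n j) ⟩
    G n j ∎
    where open ≡-Reasoning

  G-saturated : ∀ {n j} → n ≤ j → G n j ≡ G n n
  G-saturated {n} {j} n≤j = trans (cong (G n) (sym (ℕ.m+[n∸m]≡n n≤j))) (G-stable* (j ∸ n))
    where
    G-stable* : ∀ d → G n (n + d) ≡ G n n
    G-stable* zero    = cong (G n) (ℕ.+-identityʳ n)
    G-stable* (suc d) = trans (cong (G n) (ℕ.+-suc n d)) (trans (G-stable n (n + d) (ℕ.m≤m+n n d)) (G-stable* d))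

  R : ℕ → ℚ
  R n = fromℕ (n !) *ℚ G n n

  R-suc : ∀ n → R (suc n) ≡ ∑< (suc n) (λ k → fromℕ (n C k) *ℚ w (suc k) *ℚ R (n ∸ k))
  R-suc n = begin
    fromℕ (suc n * n !) *ℚ G (suc n) (suc n)
      ≡⟨ cong (_*ℚ G (suc n) (suc n)) (trans (fromℕ-homo-* (suc n) (n !)) (ℚ.*-comm (fromℕ (suc n)) (fromℕ (n !)))) ⟩
    fromℕ (n !) *ℚ fromℕ (suc n) *ℚ G (suc n) (suc n)
      ≡⟨ ℚ.*-assoc (fromℕ (n !)) (fromℕ (suc n)) (G (suc n) (suc n)) ⟩
    fromℕ (n !) *ℚ (fromℕ (suc n) *ℚ G (suc n) (suc n))
      ≡⟨ cong (fromℕ (n !) *ℚ_) (G-derivative (suc n) (suc n)) ⟩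
    fromℕ (n !) *ℚ ∑< (suc n) (λ i → ⟦ suc i ≤ suc n ⟧ *ℚ (K (suc i) *ℚ G (n ∸ i) (suc n)))
      ≡⟨ ∑ℚ.*-distribˡ-∑< (suc n) (fromℕ (n !)) (λ i → ⟦ suc i ≤ suc n ⟧ *ℚ (K (suc i) *ℚ G (n ∸ i) (suc n))) ⟩
    ∑< (suc n) (λ i → fromℕ (n !) *ℚ (⟦ suc i ≤ suc n ⟧ *ℚ (K (suc i) *ℚ G (n ∸ i) (suc n))))
      ≡⟨ ∑ℚ.∑<-cong (suc n) summand ⟩
    ∑< (suc n) (λ k → fromℕ (n C k) *ℚ w (suc k) *ℚ R (n ∸ k)) ∎
    where
    open ≡-Reasoning
    summand : ∀ i → i < suc n →
      fromℕ (n !) *ℚ (⟦ suc i ≤ suc n ⟧ *ℚ (K (suc i) *ℚ G (n ∸ i) (suc n))) ≡ fromℕ (n C i) *ℚ w (suc i) *ℚ R (n ∸ i)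
    summand i (s≤s i≤n) = begin
      fromℕ (n !) *ℚ (⟦ suc i ≤ suc n ⟧ *ℚ (K (suc i) *ℚ G (n ∸ i) (suc n)))
        ≡⟨ cong (fromℕ (n !) *ℚ_) (⟦≤⟧*-yes (K (suc i) *ℚ G (n ∸ i) (suc n)) (s≤s i≤n)) ⟩
      fromℕ (n !) *ℚ (fromℕ (suc i) *ℚ (w (suc i) *ℚ inv! (suc i)) *ℚ G (n ∸ i) (suc n))
        ≡⟨ cong (λ z → fromℕ (n !) *ℚ (fromℕ (suc i) *ℚ (w (suc i) *ℚ inv! (suc i)) *ℚ z))
                (G-saturated (ℕ.≤-trans (ℕ.m∸n≤m n i) (ℕ.n≤1+n n))) ⟩
      fromℕ (n !) *ℚ (fromℕ (suc i) *ℚ (w (suc i) *ℚ inv! (suc i)) *ℚ g)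
        ≡⟨ solve 5 (λ a b c d e → a :* (b :* (c :* d) :* e) := a :* (b :* d) :* c :* e) refl
                   (fromℕ (n !)) (fromℕ (suc i)) (w (suc i)) (inv! (suc i)) g ⟩
      fromℕ (n !) *ℚ (fromℕ (suc i) *ℚ inv! (suc i)) *ℚ w (suc i) *ℚ g
        ≡⟨ cong (λ z → fromℕ (n !) *ℚ z *ℚ w (suc i) *ℚ g) (fromℕ-suc*inv!-suc i) ⟩
      fromℕ (n !) *ℚ inv! i *ℚ w (suc i) *ℚ g
        ≡⟨ cong (λ z → z *ℚ w (suc i) *ℚ g) (fromℕ!*inv!≡binomial i≤n) ⟩
      fromℕ (n C i) *ℚ fromℕ ((n ∸ i) !) *ℚ w (suc i) *ℚ g
        ≡⟨ solve 4 (λ a b c d → a :* b :* c :* d := a :* c :* (b :* d)) refl (fromℕ (n C i)) (fromℕ ((n ∸ i) !)) (w (suc i)) g ⟩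
      fromℕ (n C i) *ℚ w (suc i) *ℚ R (n ∸ i) ∎
      where g = G (n ∸ i) (n ∸ i)

-- Integer partitions

mult-++ : ∀ xs ys i → mult (xs ++ ys) i ≡ mult xs i + mult ys i
mult-++ []       ys i = refl
mult-++ (x ∷ xs) ys i = trans (cong ((if x ≡ᵇ i then 1 else 0) +_) (mult-++ xs ys i))
                              (sym (ℕ.+-assoc (if x ≡ᵇ i then 1 else 0) (mult xs i) (mult ys i)))

mult-∷-≢ : ∀ {x i} xs → x ≢ i → mult (x ∷ xs) i ≡ mult xs i
mult-∷-≢ {x} {i} xs x≢i = cong (λ β → (if β then 1 else 0) + mult xs i) (≢⇒≡ᵇ≡false x≢i)

mult-∷-≡ : ∀ {x} xs → mult (x ∷ xs) x ≡ suc (mult xs x)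
mult-∷-≡ {x} xs = cong (λ β → (if β then 1 else 0) + mult xs x) (≡ᵇ-refl x)

mult-replicate-≢ : ∀ t {s i} → s ≢ i → mult (replicate t s) i ≡ 0
mult-replicate-≢ zero    s≢i = refl
mult-replicate-≢ (suc t) s≢i = trans (mult-∷-≢ (replicate t _) s≢i) (mult-replicate-≢ t s≢i)

mult-replicate : ∀ t s → mult (replicate t s) s ≡ t
mult-replicate zero    s = refl
mult-replicate (suc t) s = trans (mult-∷-≡ (replicate t s)) (cong suc (mult-replicate t s))

mult-< : ∀ {s} q → All (_< s) q → mult q s ≡ 0
mult-< []      []          = refl
mult-< (x ∷ q) (x<s ∷ q<s) = trans (mult-∷-≢ q (ℕ.<⇒≢ x<s)) (mult-< q q<s)

sum-replicate++ : ∀ t s q → sum (replicate t s ++ q) ≡ t * s + sum q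
sum-replicate++ zero    s q = refl
sum-replicate++ (suc t) s q = trans (cong (s +_) (sum-replicate++ t s q)) (sym (ℕ.+-assoc s (t * s) (sum q)))

parts≤sum : ∀ p → All (_≤ sum p) p
parts≤sum []      = []
parts≤sum (x ∷ p) = ℕ.m≤m+n x (sum p) ∷ All.map (λ y≤ → ℕ.≤-trans y≤ (ℕ.m≤n+m (sum p) x)) (parts≤sum p)

linked-∷ : ∀ {x xs} → All (_≤ x) xs → Linked _≥_ xs → Linked _≥_ (x ∷ xs)
linked-∷ []          _   = [-]
linked-∷ (y≤x ∷ _) sorted = y≤x ∷ sorted

linked-replicate++ : ∀ t s {q} → All (_≤ s) q → Linked _≥_ q → Linked _≥_ (replicate t s ++ q)
linked-replicate++ zero    s q≤s sorted = sorted
linked-replicate++ (suc t) s q≤s sorted =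
  linked-∷ (All.++⁺ (All.replicate⁺ t ℕ.≤-refl) q≤s) (linked-replicate++ t s q≤s sorted)

replicate++-injective : ∀ {s} t₁ t₂ {q₁ q₂} → All (_< s) q₁ → All (_< s) q₂ →
                        replicate t₁ s ++ q₁ ≡ replicate t₂ s ++ q₂ → t₁ ≡ t₂
replicate++-injective zero     zero     _         _         _  = refl
replicate++-injective zero     (suc t₂) []        _         ()
replicate++-injective zero     (suc t₂) (x<s ∷ _) _         eq = ⊥-elim (ℕ.<-irrefl (List.∷-injectiveˡ eq) x<s)
replicate++-injective (suc t₁) zero     _         []        ()
replicate++-injective (suc t₁) zero     _         (x<s ∷ _) eq = ⊥-elim (ℕ.<-irrefl (sym (List.∷-injectiveˡ eq)) x<s)
replicate++-injective (suc t₁) (suc t₂) q₁<s      q₂<s      eq =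
  cong suc (replicate++-injective t₁ t₂ q₁<s q₂<s (List.∷-injectiveʳ eq))

split-leading : ∀ s p → All (_≤ s) p → Linked _≥_ p →
  ∃[ t ] ∃[ q ] p ≡ replicate t s ++ q × All (_< s) q × Linked _≥_ q
split-leading s []      _           _      = 0 , [] , refl , [] , []
split-leading s (x ∷ p) (x≤s ∷ p≤s) sorted with x ℕ.≟ s
... | yes refl with split-leading s p p≤s (Linked.tail sorted)
...   | t , q , refl , q<s , sorted-q = suc t , q , refl , q<s , sorted-q
split-leading s (x ∷ p) (x≤s ∷ _) sorted | no x≢s =
  0 , x ∷ p , refl ,
  All.map (λ y≤x → ℕ.≤-<-trans y≤x (ℕ.≤∧≢⇒< x≤s x≢s)) (Linked⇒All ≥-trans ℕ.≤-refl sorted) , sorted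
  where
  ≥-trans : ∀ {a b c} → a ≥ b → b ≥ c → a ≥ c
  ≥-trans b≤a c≤b = ℕ.≤-trans c≤b b≤a

prependCopies : ℕ → ℕ → (ℕ → List (List ℕ)) → ℕ → List (List ℕ)
prependCopies s n P t = if t * s ≤ᵇ n then List.map (replicate t s ++_) (P (n ∸ t * s)) else []

partitionsUpTo : ℕ → ℕ → List (List ℕ)
partitionsUpTo n       (suc j) = concat (applyUpTo (prependCopies (suc j) n (λ r → partitionsUpTo r j)) (suc n))
partitionsUpTo zero    zero    = [] ∷ []
partitionsUpTo (suc n) zero    = []

copiesOf : ℕ → ℕ → ℕ → List (List ℕ)
copiesOf j n = prependCopies (suc j) n (λ r → partitionsUpTo r j)

prependCopies-yes : ∀ s n P t → t * s ≤ n → prependCopies s n P t ≡ List.map (replicate t s ++_) (P (n ∸ t * s))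
prependCopies-yes s n P t ts≤n = cong (λ β → if β then List.map (replicate t s ++_) (P (n ∸ t * s)) else []) (≤⇒≤ᵇ≡true ts≤n)

prependCopies-no : ∀ s n P t → n < t * s → prependCopies s n P t ≡ []
prependCopies-no s n P t n<ts = cong (λ β → if β then List.map (replicate t s ++_) (P (n ∸ t * s)) else []) (>⇒≤ᵇ≡false n<ts)

∈-prependCopies⁻ : ∀ s n P t {p} → p ∈ prependCopies s n P t →
  t * s ≤ n × ∃[ q ] q ∈ P (n ∸ t * s) × p ≡ replicate t s ++ q
∈-prependCopies⁻ s n P t {p} p∈ with t * s ℕ.≤? n
... | no  ts≰n with () ← subst (p ∈_) (prependCopies-no s n P t (ℕ.≰⇒> ts≰n)) p∈
... | yes ts≤n with ∈-map⁻ (replicate t s ++_) (subst (p ∈_) (prependCopies-yes s n P t ts≤n) p∈)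
...   | q , q∈ , refl = ts≤n , q , q∈ , refl

∈-prependCopies⁺ : ∀ s n P t {q} → t * s ≤ n → q ∈ P (n ∸ t * s) → replicate t s ++ q ∈ prependCopies s n P t
∈-prependCopies⁺ s n P t {q} ts≤n q∈ =
  subst (replicate t s ++ q ∈_) (sym (prependCopies-yes s n P t ts≤n)) (∈-map⁺ (replicate t s ++_) q∈)

∈-partitionsUpTo-suc⁻ : ∀ n j {p} → p ∈ partitionsUpTo n (suc j) →
  ∃[ t ] t * suc j ≤ n × ∃[ q ] q ∈ partitionsUpTo (n ∸ t * suc j) j × p ≡ replicate t (suc j) ++ q
∈-partitionsUpTo-suc⁻ n j p∈ with Any.applyUpTo⁻ (copiesOf j n) (∈-concat⁻ (applyUpTo (copiesOf j n) (suc n)) p∈)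
... | t , _ , p∈t = t , ∈-prependCopies⁻ (suc j) n (λ r → partitionsUpTo r j) t p∈t

∈-partitionsUpTo-suc⁺ : ∀ n j t {q} → t * suc j ≤ n → q ∈ partitionsUpTo (n ∸ t * suc j) j →
  replicate t (suc j) ++ q ∈ partitionsUpTo n (suc j)
∈-partitionsUpTo-suc⁺ n j t ts≤n q∈ = ∈-concat⁺ (Any.applyUpTo⁺ (copiesOf j n)
  (∈-prependCopies⁺ (suc j) n (λ r → partitionsUpTo r j) t ts≤n q∈) (s≤s (ℕ.≤-trans (ℕ.m≤m*n t (suc j)) ts≤n)))

partitionsUpTo-sound : ∀ j n {p} → p ∈ partitionsUpTo n j → IsIntPartition n p × All (_≤ j) p
partitionsUpTo-sound zero    zero    (here refl) = ([] , [] , refl) , []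
partitionsUpTo-sound (suc j) n       p∈ with ∈-partitionsUpTo-suc⁻ n j p∈
... | t , ts≤n , q , q∈ , refl with partitionsUpTo-sound j (n ∸ t * suc j) q∈
...   | (positive , sorted , sum≡) , q≤j =
  ( All.++⁺ (All.replicate⁺ t (s≤s z≤n)) positive
  , linked-replicate++ t (suc j) (All.map ℕ.m≤n⇒m≤1+n q≤j) sorted
  , trans (sum-replicate++ t (suc j) q) (trans (cong (t * suc j +_) sum≡) (ℕ.m+[n∸m]≡n ts≤n)) )
  , All.++⁺ (All.replicate⁺ t ℕ.≤-refl) (All.map ℕ.m≤n⇒m≤1+n q≤j)

partitionsUpTo-complete : ∀ j n {p} → IsIntPartition n p → All (_≤ j) p → p ∈ partitionsUpTo n j
partitionsUpTo-complete zero    n {[]}    (_ , _ , refl) _ = here refl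
partitionsUpTo-complete zero    n {x ∷ p} (1≤x ∷ _ , _) (x≤0 ∷ _) = ⊥-elim (ℕ.<⇒≱ 1≤x x≤0)
partitionsUpTo-complete (suc j) n {p} (positive , sorted , sum≡) p≤s
  with split-leading (suc j) p p≤s sorted
... | t , q , refl , q<s , sorted-q = ∈-partitionsUpTo-suc⁺ n j t ts≤n
  (partitionsUpTo-complete j (n ∸ t * suc j) (All.++⁻ʳ (replicate t (suc j)) positive , sorted-q , sum-q) (All.map ℕ.≤-pred q<s))
  where
  n≡ : t * suc j + sum q ≡ n
  n≡ = trans (sym (sum-replicate++ t (suc j) q)) sum≡
  ts≤n : t * suc j ≤ n
  ts≤n = subst (t * suc j ≤_) n≡ (ℕ.m≤m+n _ _)
  sum-q : sum q ≡ n ∸ t * suc j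
  sum-q = trans (sym (ℕ.m+n∸m≡n (t * suc j) (sum q))) (cong (_∸ t * suc j) n≡)

partitionsUpTo-unique : ∀ j n → Unique (partitionsUpTo n j)
partitionsUpTo-unique zero    zero    = [] ∷ []
partitionsUpTo-unique zero    (suc n) = []
partitionsUpTo-unique (suc j) n = Unique.concat⁺
  (All.applyUpTo⁺₂ _ (suc n) each-unique) (AllPairs.applyUpTo⁺₁ _ (suc n) (λ t₁<t₂ _ → disjoint t₁<t₂))
  where
  P = λ r → partitionsUpTo r j
  each-unique : ∀ t → Unique (copiesOf j n t)
  each-unique t with t * suc j ≤ᵇ n
  ... | true  = Unique.map⁺ (λ {x} {y} → List.++-cancelˡ (replicate t (suc j)) x y) (partitionsUpTo-unique j (n ∸ t * suc j))
  ... | false = []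
  parts<s : ∀ {r q} → q ∈ P r → All (_< suc j) q
  parts<s q∈ = All.map s≤s (proj₂ (partitionsUpTo-sound j _ q∈))
  disjoint : ∀ {t₁ t₂} → t₁ < t₂ → ∀ {p} → ¬ (p ∈ copiesOf j n t₁ × p ∈ copiesOf j n t₂)
  disjoint {t₁} {t₂} t₁<t₂ (p∈₁ , p∈₂)
    with ∈-prependCopies⁻ (suc j) n P t₁ p∈₁ | ∈-prependCopies⁻ (suc j) n P t₂ p∈₂
  ... | _ , q₁ , q₁∈ , refl | _ , q₂ , q₂∈ , eq =
    ℕ.<-irrefl (replicate++-injective t₁ t₂ (parts<s q₁∈) (parts<s q₂∈) eq) t₁<t₂

partsUpTo : ℕ → List ℕ
partsUpTo j = List.map suc (List.upTo j)

partsUpTo-suc : ∀ j → partsUpTo (suc j) ≡ partsUpTo j ++ suc j ∷ []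
partsUpTo-suc j = trans (cong (List.map suc) (sym (List.upTo-∷ʳ j))) (List.map-++ suc (List.upTo j) (j ∷ []))

module PartitionWeights (w : ℕ → ℚ) where

  open ExponentialFormula w

  multiplicityFactor : ℕ → List ℕ → ℚ
  multiplicityFactor j p = productℚ (List.map (λ i → inv! (mult p i)) (partsUpTo j))

  weight : ℕ → List ℕ → ℚ
  weight j p = productℚ (List.map u p) *ℚ multiplicityFactor j p

  multiplicityFactor-prepend : ∀ j t q → All (_≤ j) q →
    multiplicityFactor (suc j) (replicate t (suc j) ++ q) ≡ multiplicityFactor j q *ℚ inv! t
  multiplicityFactor-prepend j t q q≤j = begin
    productℚ (List.map factor (partsUpTo (suc j)))
      ≡⟨ cong (λ is → productℚ (List.map factor is)) (partsUpTo-suc j) ⟩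
    productℚ (List.map factor (partsUpTo j ++ suc j ∷ []))
      ≡⟨ cong productℚ (List.map-++ factor (partsUpTo j) (suc j ∷ [])) ⟩
    productℚ (List.map factor (partsUpTo j) ++ factor (suc j) ∷ [])
      ≡⟨ productℚ-++ (List.map factor (partsUpTo j)) (factor (suc j) ∷ []) ⟩
    productℚ (List.map factor (partsUpTo j)) *ℚ (factor (suc j) *ℚ 1ℚ)
      ≡⟨ cong₂ _*ℚ_ (productℚ-map-cong (partsUpTo j) smaller-parts) (trans (ℚ.*-identityʳ _) (cong inv! largest-part)) ⟩
    multiplicityFactor j q *ℚ inv! t ∎
    where
    open ≡-Reasoning
    factor : ℕ → ℚ
    factor i = inv! (mult (replicate t (suc j) ++ q) i)
    smaller-parts : ∀ {i} → i ∈ partsUpTo j → factor i ≡ inv! (mult q i)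
    smaller-parts i∈ with ∈-map⁻ suc i∈
    ... | k , k∈ , refl = cong inv! (trans (mult-++ (replicate t (suc j)) q (suc k))
      (cong (_+ mult q (suc k)) (mult-replicate-≢ t (λ j≡k → ℕ.<-irrefl (sym (ℕ.suc-injective j≡k)) (∈-upTo⁻ k∈)))))
    largest-part : mult (replicate t (suc j) ++ q) (suc j) ≡ t
    largest-part = trans (mult-++ (replicate t (suc j)) q (suc j))
      (trans (cong₂ _+_ (mult-replicate t (suc j)) (mult-< q (All.map s≤s q≤j))) (ℕ.+-identityʳ t))

  productℚ-u-replicate++ : ∀ t s q → productℚ (List.map u (replicate t s ++ q)) ≡ u s ^ℚ t *ℚ productℚ (List.map u q)
  productℚ-u-replicate++ zero    s q = sym (ℚ.*-identityˡ _)
  productℚ-u-replicate++ (suc t) s q =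
    trans (cong (u s *ℚ_) (productℚ-u-replicate++ t s q)) (sym (ℚ.*-assoc (u s) (u s ^ℚ t) (productℚ (List.map u q))))

  weight-prepend : ∀ j t q → All (_≤ j) q → weight (suc j) (replicate t (suc j) ++ q) ≡ expTerm (suc j) t *ℚ weight j q
  weight-prepend j t q q≤j = trans (cong₂ _*ℚ_ (productℚ-u-replicate++ t (suc j) q) (multiplicityFactor-prepend j t q q≤j))
    (solve 4 (λ a b c d → a :* b :* (c :* d) := a :* d :* (b :* c)) refl
      (u (suc j) ^ℚ t) (productℚ (List.map u q)) (multiplicityFactor j q) (inv! t))

  ∑weight≡G : ∀ j n → sumℚ (List.map (weight j) (partitionsUpTo n j)) ≡ G n j
  ∑weight≡G zero    zero    = refl
  ∑weight≡G zero    (suc n) = refl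
  ∑weight≡G (suc j) n = trans (sumℚ-concat-applyUpTo (suc n) (weight (suc j)) (copiesOf j n))
                              (∑ℚ.∑<-cong (suc n) (λ t _ → ∑weight-copies t))
    where
    P = λ r → partitionsUpTo r j
    ∑weight-copies : ∀ t → sumℚ (List.map (weight (suc j)) (copiesOf j n t))
                         ≡ ⟦ t * suc j ≤ n ⟧ *ℚ (expTerm (suc j) t *ℚ G (n ∸ t * suc j) j)
    ∑weight-copies t = case-split (t * suc j ℕ.≤? n)
      where
      qs = P (n ∸ t * suc j)
      case-split : Dec (t * suc j ≤ n) → sumℚ (List.map (weight (suc j)) (copiesOf j n t))
                                       ≡ ⟦ t * suc j ≤ n ⟧ *ℚ (expTerm (suc j) t *ℚ G (n ∸ t * suc j) j)
      case-split (no ts≰n) = trans (cong (λ ps → sumℚ (List.map (weight (suc j)) ps)) (prependCopies-no (suc j) n P t (ℕ.≰⇒> ts≰n)))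
                                   (sym (⟦≤⟧*-no (expTerm (suc j) t *ℚ G (n ∸ t * suc j) j) (ℕ.≰⇒> ts≰n)))
      case-split (yes ts≤n) = begin
        sumℚ (List.map (weight (suc j)) (copiesOf j n t))
          ≡⟨ cong (λ ps → sumℚ (List.map (weight (suc j)) ps)) (prependCopies-yes (suc j) n P t ts≤n) ⟩
        sumℚ (List.map (weight (suc j)) (List.map (replicate t (suc j) ++_) qs))
          ≡⟨ cong sumℚ (sym (List.map-∘ qs)) ⟩
        sumℚ (List.map (λ q → weight (suc j) (replicate t (suc j) ++ q)) qs)
          ≡⟨ sumℚ-map-cong qs (λ q∈ → weight-prepend j t _ (proj₂ (partitionsUpTo-sound j (n ∸ t * suc j) q∈))) ⟩
        sumℚ (List.map (λ q → expTerm (suc j) t *ℚ weight j q) qs)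
          ≡⟨ sumℚ-map-*ˡ (expTerm (suc j) t) (weight j) qs ⟩
        expTerm (suc j) t *ℚ sumℚ (List.map (weight j) qs)
          ≡⟨ cong (expTerm (suc j) t *ℚ_) (∑weight≡G j (n ∸ t * suc j)) ⟩
        expTerm (suc j) t *ℚ G (n ∸ t * suc j) j
          ≡⟨ ⟦≤⟧*-yes (expTerm (suc j) t *ℚ G (n ∸ t * suc j) j) ts≤n ⟨
        ⟦ t * suc j ≤ n ⟧ *ℚ (expTerm (suc j) t *ℚ G (n ∸ t * suc j) j) ∎
        where open ≡-Reasoning

  weight≡ : ∀ j p → weight j p ≡ productℚ (List.map inv! p) *ℚ multiplicityFactor j p *ℚ productℚ (List.map w p)
  weight≡ j p = trans (cong (_*ℚ multiplicityFactor j p) (trans (productℚ-map-* w inv! p)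
                             (ℚ.*-comm (productℚ (List.map w p)) (productℚ (List.map inv! p)))))
    (solve 3 (λ a b c → a :* b :* c := a :* c :* b) refl (productℚ (List.map inv! p)) (productℚ (List.map w p)) (multiplicityFactor j p))

  ∑weight≡G-over : ∀ n (L : List (List ℕ)) → Unique L → (∀ p → (p ∈ L) ⇔ IsIntPartition n p) →
    sumℚ (List.map (weight n) L) ≡ G n n
  ∑weight≡G-over n L unique-L L⇔ = trans
    (sumℚ-map-↭ (weight n) (∼bag⇒↭ (unique∧set⇒bag unique-L (partitionsUpTo-unique n n) same-members)))
    (∑weight≡G n n)
    where
    same-members : ∀ {p} → (p ∈ L) ⇔ (p ∈ partitionsUpTo n n)
    same-members {p} = mk⇔
      (λ p∈L → let p-partition = Equivalence.to (L⇔ p) p∈L in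
        partitionsUpTo-complete n n p-partition (subst (λ k → All (_≤ k) p) (proj₂ (proj₂ p-partition)) (parts≤sum p)))
      (λ p∈ → Equivalence.from (L⇔ p) (proj₁ (partitionsUpTo-sound n n p∈)))

↔Fin-⊎ : ∀ {A B : Set} {a b} → A ↔ Fin a → B ↔ Fin b → (A ⊎ B) ↔ Fin (a + b)
↔Fin-⊎ A↔a B↔b = ↔-trans (A↔a ⊎-↔ B↔b) (↔-sym Finₚ.+↔⊎)

↔Fin-× : ∀ {A B : Set} {a b} → A ↔ Fin a → B ↔ Fin b → (A × B) ↔ Fin (a * b)
↔Fin-× A↔a B↔b = ↔-trans (A↔a ×-↔ B↔b) (↔-sym Finₚ.*↔×)

#in : ∀ {n} → Vec Bool n → ℕ
#in []           = 0
#in (true  ∷ bs) = suc (#in bs)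
#in (false ∷ bs) = #in bs

#out : ∀ {n} → Vec Bool n → ℕ
#out []           = 0
#out (true  ∷ bs) = #out bs
#out (false ∷ bs) = suc (#out bs)

#out≤ : ∀ {n} (bs : Vec Bool n) → #out bs ≤ n
#out≤ []           = z≤n
#out≤ (true  ∷ bs) = ℕ.m≤n⇒m≤1+n (#out≤ bs)
#out≤ (false ∷ bs) = s≤s (#out≤ bs)

select : ∀ {A : Set} {n} (ms : Vec Bool n) → Vec A n → Vec A (#in ms)
select [] [] = []
select (true ∷ ms) (x ∷ v) = x ∷ select ms v
select (false ∷ ms) (x ∷ v) = select ms v

reject : ∀ {A : Set} {n} (ms : Vec Bool n) → Vec A n → Vec A (#out ms)
reject [] [] = []
reject (true ∷ ms) (x ∷ v) = reject ms v
reject (false ∷ ms) (x ∷ v) = x ∷ reject ms v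

merge : ∀ {A : Set} {n} (ms : Vec Bool n) → Vec A (#in ms) → Vec A (#out ms) → Vec A n
merge [] [] [] = []
merge (true ∷ ms) (x ∷ xs) ys = x ∷ merge ms xs ys
merge (false ∷ ms) xs (y ∷ ys) = y ∷ merge ms xs ys

select-merge : ∀ {A : Set} {n} (ms : Vec Bool n) (xs : Vec A (#in ms)) ys → select ms (merge ms xs ys) ≡ xs
select-merge [] [] [] = refl
select-merge (true ∷ ms) (x ∷ xs) ys = cong (x ∷_) (select-merge ms xs ys)
select-merge (false ∷ ms) xs (y ∷ ys) = select-merge ms xs ys

reject-merge : ∀ {A : Set} {n} (ms : Vec Bool n) (xs : Vec A (#in ms)) ys → reject ms (merge ms xs ys) ≡ ys
reject-merge [] [] [] = refl
reject-merge (true ∷ ms) (x ∷ xs) ys = reject-merge ms xs ys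
reject-merge (false ∷ ms) xs (y ∷ ys) = cong (y ∷_) (reject-merge ms xs ys)

merge-select-reject : ∀ {A : Set} {n} (ms : Vec Bool n) (v : Vec A n) → merge ms (select ms v) (reject ms v) ≡ v
merge-select-reject [] [] = refl
merge-select-reject (true ∷ ms) (x ∷ v) = cong (x ∷_) (merge-select-reject ms v)
merge-select-reject (false ∷ ms) (x ∷ v) = cong (x ∷_) (merge-select-reject ms v)

∑Subsets : ∀ n → (Vec Bool n → ℕ) → ℕ
∑Subsets zero    g = g []
∑Subsets (suc n) g = ∑Subsets n (λ bs → g (false ∷ bs)) + ∑Subsets n (λ bs → g (true ∷ bs))

Σ-Vec-suc↔ : ∀ n (P : Vec Bool (suc n) → Set) →
  Σ (Vec Bool (suc n)) P ↔ (Σ (Vec Bool n) (λ bs → P (false ∷ bs)) ⊎ Σ (Vec Bool n) (λ bs → P (true ∷ bs)))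
Σ-Vec-suc↔ n P = mk↔ₛ′
  (λ { (false ∷ bs , p) → inj₁ (bs , p) ; (true ∷ bs , p) → inj₂ (bs , p) })
  (λ { (inj₁ (bs , p)) → false ∷ bs , p ; (inj₂ (bs , p)) → true ∷ bs , p })
  (λ { (inj₁ _) → refl ; (inj₂ _) → refl })
  (λ { (false ∷ _ , _) → refl ; (true ∷ _ , _) → refl })

Σ-Subsets↔Fin : ∀ n (P : Vec Bool n → Set) (g : Vec Bool n → ℕ) → (∀ bs → P bs ↔ Fin (g bs)) →
                Σ (Vec Bool n) P ↔ Fin (∑Subsets n g)
Σ-Subsets↔Fin zero    P g P↔g = ↔-trans (mk↔ₛ′ (λ { ([] , p) → p }) ([] ,_) (λ _ → refl) (λ { ([] , _) → refl })) (P↔g [])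
Σ-Subsets↔Fin (suc n) P g P↔g = ↔-trans (Σ-Vec-suc↔ n P)
  (↔Fin-⊎ (Σ-Subsets↔Fin n _ _ (λ bs → P↔g (false ∷ bs))) (Σ-Subsets↔Fin n _ _ (λ bs → P↔g (true ∷ bs))))

∑Subsets-binomial : ∀ n (F : ℕ → ℕ → ℕ) →
  ∑Subsets n (λ bs → F (#in bs) (#out bs)) ≡ ∑ℕ.∑< (suc n) (λ k → (n C k) * F k (n ∸ k))
∑Subsets-binomial zero    F = sym (trans (ℕ.+-identityʳ (1 * F 0 0)) (ℕ.*-identityˡ (F 0 0)))
∑Subsets-binomial (suc n) F = begin
  ∑Subsets n (λ bs → F (#in bs) (suc (#out bs))) + ∑Subsets n (λ bs → F (suc (#in bs)) (#out bs))
    ≡⟨ cong₂ _+_ (∑Subsets-binomial n (λ k l → F k (suc l))) (∑Subsets-binomial n (λ k l → F (suc k) l)) ⟩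
  (1 * F 0 (suc n) + ∑ℕ.∑< n (λ k → (n C suc k) * F (suc k) (suc (n ∸ suc k)))) + ∑ℕ.∑< (suc n) old
    ≡⟨ cong (λ z → (1 * F 0 (suc n) + z) + ∑ℕ.∑< (suc n) old)
            (trans (∑ℕ.∑<-cong n (λ k k<n → cong (λ r → (n C suc k) * F (suc k) r) (sym (ℕ.+-∸-assoc 1 k<n)))) (sym new-last)) ⟩
  (1 * F 0 (suc n) + ∑ℕ.∑< (suc n) new) + ∑ℕ.∑< (suc n) old
    ≡⟨ trans (ℕ.+-assoc (1 * F 0 (suc n)) _ _) (cong (1 * F 0 (suc n) +_) (ℕ.+-comm (∑ℕ.∑< (suc n) new) _)) ⟩
  1 * F 0 (suc n) + (∑ℕ.∑< (suc n) old + ∑ℕ.∑< (suc n) new)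
    ≡⟨ cong (1 * F 0 (suc n) +_) (sym (∑ℕ.∑<-distrib-+ (suc n) old new)) ⟩
  1 * F 0 (suc n) + ∑ℕ.∑< (suc n) (λ k → old k + new k)
    ≡⟨ cong (1 * F 0 (suc n) +_) (∑ℕ.∑<-cong (suc n) (λ k _ → pascal k)) ⟩
  1 * F 0 (suc n) + ∑ℕ.∑< (suc n) (λ k → (suc n C suc k) * F (suc k) (n ∸ k)) ∎
  where
  open ≡-Reasoning
  old new : ℕ → ℕ
  old k = (n C k) * F (suc k) (n ∸ k)
  new k = (n C suc k) * F (suc k) (n ∸ k)
  new-last : ∑ℕ.∑< (suc n) new ≡ ∑ℕ.∑< n new
  new-last = trans (∑ℕ.∑<-snoc n new) (trans (cong (λ z → ∑ℕ.∑< n new + z * F (suc n) (n ∸ n)) (k>n⇒nCk≡0 (ℕ.n<1+n n)))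
                                          (ℕ.+-identityʳ _))
  pascal : ∀ k → old k + new k ≡ (suc n C suc k) * F (suc k) (n ∸ k)
  pascal k = trans (sym (ℕ.*-distribʳ-+ (F (suc k) (n ∸ k)) (n C k) (n C suc k))) (cong (_* F (suc k) (n ∸ k)) (nCk+nC[k+1]≡[n+1]C[k+1] n k))

-- Counting colorings

bool-irrelevant : ∀ {x y : Bool} (p q : x ≡ y) → p ≡ q
bool-irrelevant = Decidable⇒UIP.≡-irrelevant Bool._≟_

mask-irrelevant : ∀ {n} {xs ys : Vec Bool n} (p q : xs ≡ ys) → p ≡ q
mask-irrelevant = Decidable⇒UIP.≡-irrelevant (Vecₚ.≡-dec Bool._≟_)

≢ᵇ↔Fin-pred : ∀ {c} (b : Fin c) → Σ (Fin c) (λ x → (toℕ x ≡ᵇ toℕ b) ≡ false) ↔ Fin (c ∸ 1)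
≢ᵇ↔Fin-pred {suc c} b = mk↔ₛ′
  (λ (x , x≢b) → Fin.punchOut (≢ᵇ⇒≢ x≢b))
  (λ y → Fin.punchIn b y , ≢⇒≢ᵇ (Finₚ.punchInᵢ≢i b y))
  (λ y → trans (Finₚ.punchOut-cong b refl) (Finₚ.punchOut-punchIn b))
  (λ (x , x≢b) → Σ-≡,≡→≡ (Finₚ.punchIn-punchOut (≢ᵇ⇒≢ x≢b) , bool-irrelevant _ _))
  where
  ≢ᵇ⇒≢ : ∀ {x} → (toℕ x ≡ᵇ toℕ b) ≡ false → b ≢ x
  ≢ᵇ⇒≢ {x} x≢ᵇb refl with () ← trans (sym (≡ᵇ-refl (toℕ x))) x≢ᵇb
  ≢⇒≢ᵇ : ∀ {x} → x ≢ b → (toℕ x ≡ᵇ toℕ b) ≡ false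
  ≢⇒≢ᵇ x≢b = ≢⇒≡ᵇ≡false (λ toℕx≡toℕb → x≢b (Finₚ.toℕ-injective toℕx≡toℕb))

module BoundedColorings {c : ℕ} (a : Fin c) where

  isA : Fin c → Bool
  isA x = toℕ x ≡ᵇ toℕ a

  δₐ : Fin c → ℕ
  δₐ x = if isA x then 1 else 0

  #a : ∀ {p} → Vec (Fin c) p → ℕ
  #a []       = 0
  #a (x ∷ xs) = δₐ x + #a xs

  isA-a : isA a ≡ true
  isA-a = ≡ᵇ-refl (toℕ a)

  isA⇒≡a : ∀ {x} → isA x ≡ true → x ≡ a
  isA⇒≡a isA-x = Finₚ.toℕ-injective (≡ᵇ≡true⇒≡ isA-x)

  Coloring≤ : ℕ → ℕ → Set
  Coloring≤ p k = Σ (Vec (Fin c) p) (λ xs → #a xs ≤ k)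

  Coloring< : ℕ → ℕ → Set
  Coloring< p zero    = ⊥
  Coloring< p (suc k) = Coloring≤ p k

  OtherColor : Set
  OtherColor = Σ (Fin c) (λ x → isA x ≡ false)

  Coloring≤-≡ : ∀ {p k} {xs ys : Vec (Fin c) p} {xs≤k : #a xs ≤ k} {ys≤k : #a ys ≤ k} → xs ≡ ys → (xs , xs≤k) ≡ (ys , ys≤k)
  Coloring≤-≡ {xs≤k = xs≤k} {ys≤k} refl = cong (_ ,_) (ℕ.≤-irrelevant xs≤k ys≤k)

  bound-subst : ∀ {β β′} k {p} (xs : Vec (Fin c) p) → β ≡ β′ →
                (if β then 1 else 0) + #a xs ≤ k → (if β′ then 1 else 0) + #a xs ≤ k
  bound-subst k xs β≡β′ = subst (λ β → (if β then 1 else 0) + #a xs ≤ k) β≡β′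

  -- The outcome of the color test is passed along with its proof, so that the
  -- inverse laws below can replay the case split.
  first-color : ∀ {p k} x (xs : Vec (Fin c) p) → δₐ x + #a xs ≤ k →
                (β : Bool) → isA x ≡ β → Coloring< p k ⊎ (OtherColor × Coloring≤ p k)
  first-color {k = k}     x xs bound false isA-x = inj₂ ((x , isA-x) , xs , bound-subst k xs isA-x bound)
  first-color {k = suc k} x xs bound true  isA-x = inj₁ (xs , ℕ.≤-pred (bound-subst (suc k) xs isA-x bound))
  first-color {k = zero}  x xs bound true  isA-x with () ← bound-subst 0 xs isA-x bound

  split-first : ∀ {p k} → Coloring≤ (suc p) k → Coloring< p k ⊎ (OtherColor × Coloring≤ p k)
  split-first (x ∷ xs , bound) = first-color x xs bound (isA x) refl

  join-first : ∀ {p k} → Coloring< p k ⊎ (OtherColor × Coloring≤ p k) → Coloring≤ (suc p) k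
  join-first {k = k}     (inj₂ ((x , isA-x) , xs , bound)) = x ∷ xs , bound-subst k xs (sym isA-x) bound
  join-first {k = suc k} (inj₁ (xs , bound))               = a ∷ xs , bound-subst (suc k) xs (sym isA-a) (s≤s bound)

  split-join : ∀ {p k} y → split-first {p} {k} (join-first y) ≡ y
  split-join {k = suc k} (inj₁ (xs , bound)) = a-first (isA a) refl
    where
    a-first : ∀ β e → first-color a xs (proj₂ (join-first (inj₁ (xs , bound)))) β e ≡ inj₁ (xs , bound)
    a-first true  _     = cong inj₁ (Coloring≤-≡ refl)
    a-first false isA-a′ with () ← trans (sym isA-a) isA-a′
  split-join {k = k} (inj₂ ((x , isA-x) , xs , bound)) = other-first (isA x) refl
    where
    other-first : ∀ β e → first-color x xs (proj₂ (join-first {k = k} (inj₂ ((x , isA-x) , xs , bound)))) β e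
                        ≡ inj₂ ((x , isA-x) , xs , bound)
    other-first false isA-x′ rewrite bool-irrelevant isA-x′ isA-x = cong (λ ys → inj₂ ((x , isA-x) , ys)) (Coloring≤-≡ refl)
    other-first true  isA-x′ with () ← trans (sym isA-x′) isA-x

  join-split : ∀ {p k} y → join-first {p} {k} (split-first y) ≡ y
  join-split {p} {k} (x ∷ xs , bound) = join-first-color k bound (isA x) refl
    where
    join-first-color : ∀ k (bound : δₐ x + #a xs ≤ k) β e → join-first (first-color x xs bound β e) ≡ (x ∷ xs , bound)
    join-first-color k       bound false _     = Coloring≤-≡ refl
    join-first-color (suc k) bound true  isA-x = Coloring≤-≡ (cong (_∷ xs) (sym (isA⇒≡a isA-x)))
    join-first-color zero    bound true  isA-x with () ← bound-subst 0 xs isA-x bound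

  #Coloring≤ : ℕ → ℕ → ℕ
  #Coloring< : ℕ → ℕ → ℕ
  #Coloring≤ zero    k = 1
  #Coloring≤ (suc p) k = #Coloring< p k + (c ∸ 1) * #Coloring≤ p k
  #Coloring< p zero    = 0
  #Coloring< p (suc k) = #Coloring≤ p k

  Coloring≤↔Fin : ∀ p k → Coloring≤ p k ↔ Fin (#Coloring≤ p k)
  Coloring<↔Fin : ∀ p k → Coloring< p k ↔ Fin (#Coloring< p k)
  Coloring≤↔Fin zero    k = ↔-trans (mk↔ₛ′ (λ _ → tt) (λ _ → [] , z≤n) (λ _ → refl) (λ { ([] , _) → Coloring≤-≡ refl }))
                                     (↔-sym Finₚ.1↔⊤)
  Coloring≤↔Fin (suc p) k = ↔-trans (mk↔ₛ′ split-first join-first split-join join-split)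
    (↔Fin-⊎ (Coloring<↔Fin p k) (↔Fin-× (≢ᵇ↔Fin-pred a) (Coloring≤↔Fin p k)))
  Coloring<↔Fin p zero    = ↔-sym Finₚ.0↔⊥
  Coloring<↔Fin p (suc k) = Coloring≤↔Fin p k

  binomialTerm : ℕ → ℕ → ℕ
  binomialTerm p ℓ = (p C ℓ) * (c ∸ 1) ^ (p ∸ ℓ)

  binomialTerm-suc : ∀ p ℓ → binomialTerm (suc p) (suc ℓ) ≡ binomialTerm p ℓ + (c ∸ 1) * binomialTerm p (suc ℓ)
  binomialTerm-suc p ℓ = begin
    (suc p C suc ℓ) * d ^ (p ∸ ℓ)                          ≡⟨ cong (_* d ^ (p ∸ ℓ)) (nCk+nC[k+1]≡[n+1]C[k+1] p ℓ) ⟨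
    ((p C ℓ) + (p C suc ℓ)) * d ^ (p ∸ ℓ)                ≡⟨ ℕ.*-distribʳ-+ (d ^ (p ∸ ℓ)) (p C ℓ) (p C suc ℓ) ⟩
    binomialTerm p ℓ + (p C suc ℓ) * d ^ (p ∸ ℓ)         ≡⟨ cong (binomialTerm p ℓ +_) shifted ⟩
    binomialTerm p ℓ + d * binomialTerm p (suc ℓ) ∎
    where
    open ≡-Reasoning
    d = c ∸ 1
    shifted : (p C suc ℓ) * d ^ (p ∸ ℓ) ≡ d * binomialTerm p (suc ℓ)
    shifted with suc ℓ ℕ.≤? p
    ... | yes ℓ<p = trans (cong (λ r → (p C suc ℓ) * d ^ r) (ℕ.+-∸-assoc 1 ℓ<p))
                          (x*[y*z]≡y*[x*z] (p C suc ℓ) d (d ^ (p ∸ suc ℓ)))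
      where
      x*[y*z]≡y*[x*z] : ∀ x y z → x * (y * z) ≡ y * (x * z)
      x*[y*z]≡y*[x*z] = solve-∀
    ... | no  ℓ≮p = trans (cong (_* d ^ (p ∸ ℓ)) p<C) (sym (trans (cong (λ z → d * (z * d ^ (p ∸ suc ℓ))) p<C) (ℕ.*-zeroʳ d)))
      where
      p<C : p C suc ℓ ≡ 0
      p<C = k>n⇒nCk≡0 (ℕ.≰⇒> ℓ≮p)

  #Coloring≤≡∑ : ∀ p k → #Coloring≤ p k ≡ ∑ℕ.∑< (suc k) (binomialTerm p)
  #Coloring<≡∑ : ∀ p k → #Coloring< p k ≡ ∑ℕ.∑< k (binomialTerm p)
  #Coloring<≡∑ p zero    = refl
  #Coloring<≡∑ p (suc k) = #Coloring≤≡∑ p k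
  #Coloring≤≡∑ zero    k =
    sym (cong (1 +_) (∑ℕ.∑<-zero k (λ ℓ _ → cong (_* (c ∸ 1) ^ (0 ∸ suc ℓ)) (k>n⇒nCk≡0 (s≤s (z≤n {ℓ}))))))
  #Coloring≤≡∑ (suc p) k = begin
    #Coloring< p k + d * #Coloring≤ p k
      ≡⟨ cong₂ (λ x y → x + d * y) (#Coloring<≡∑ p k) (#Coloring≤≡∑ p k) ⟩
    A + d * (binomialTerm p 0 + B)
      ≡⟨ rearrange A d (binomialTerm p 0) B ⟩
    d * binomialTerm p 0 + (A + d * B)
      ≡⟨ cong (d * binomialTerm p 0 +_) (sym (trans (∑ℕ.∑<-distrib-+ k (binomialTerm p) (λ ℓ → d * binomialTerm p (suc ℓ)))
                                                        (cong (A +_) (sym (∑ℕ.*-distribˡ-∑< k d (λ ℓ → binomialTerm p (suc ℓ))))))) ⟩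
    d * binomialTerm p 0 + ∑ℕ.∑< k (λ ℓ → binomialTerm p ℓ + d * binomialTerm p (suc ℓ))
      ≡⟨ cong₂ _+_ first-term (sym (∑ℕ.∑<-cong k (λ ℓ _ → binomialTerm-suc p ℓ))) ⟩
    binomialTerm (suc p) 0 + ∑ℕ.∑< k (λ ℓ → binomialTerm (suc p) (suc ℓ)) ∎
    where
    open ≡-Reasoning
    d = c ∸ 1
    A = ∑ℕ.∑< k (binomialTerm p)
    B = ∑ℕ.∑< k (λ ℓ → binomialTerm p (suc ℓ))
    rearrange : ∀ a x y z → a + x * (y + z) ≡ x * y + (a + x * z)
    rearrange = solve-∀
    first-term : d * binomialTerm p 0 ≡ binomialTerm (suc p) 0
    first-term = trans (cong (d *_) (ℕ.*-identityˡ (d ^ p))) (sym (ℕ.*-identityˡ (d * d ^ p)))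

  #Coloring≤≡innerSum : ∀ p k → #Coloring≤ p k ≡ innerSum c k p
  #Coloring≤≡innerSum p k = trans (#Coloring≤≡∑ p k) (sym (sum-map-upTo (suc k) (binomialTerm p)))

-- Restricted growth strings

allᵇ-⇒ : ∀ (f : ℕ → Bool) k (g : ℕ → ℕ) → allᵇ f (applyUpTo g k) ≡ true → ∀ i → i < k → f (g i) ≡ true
allᵇ-⇒ f (suc k) g all-f zero    _         = Bool.∧-conicalˡ _ _ all-f
allᵇ-⇒ f (suc k) g all-f (suc i) (s≤s i<k) = allᵇ-⇒ f k (λ z → g (suc z)) (Bool.∧-conicalʳ _ _ all-f) i i<k

allᵇ-⇐ : ∀ (f : ℕ → Bool) k (g : ℕ → ℕ) → (∀ i → i < k → f (g i) ≡ true) → allᵇ f (applyUpTo g k) ≡ true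
allᵇ-⇐ f zero    g f≡true = refl
allᵇ-⇐ f (suc k) g f≡true =
  cong₂ _∧_ (f≡true 0 (s≤s z≤n)) (allᵇ-⇐ f k (λ z → g (suc z)) (λ i i<k → f≡true (suc i) (s≤s i<k)))

isZero : ℕ → Bool
isZero zero    = true
isZero (suc _) = false

zeroMask : ∀ {n} → Vec ℕ n → Vec Bool n
zeroMask = Vec.map isZero

extendLabels : ∀ {n} (ms : Vec Bool n) → Vec ℕ (#out ms) → Vec ℕ n
extendLabels ms ls = merge ms (Vec.replicate (#in ms) 0) (Vec.map suc ls)

restLabels : ∀ {n} (ms : Vec Bool n) → Vec ℕ n → Vec ℕ (#out ms)
restLabels ms ls = Vec.map pred (reject ms ls)

zeroMask-extendLabels : ∀ {n} (ms : Vec Bool n) ls → zeroMask (extendLabels ms ls) ≡ ms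
zeroMask-extendLabels []           []       = refl
zeroMask-extendLabels (true  ∷ ms) ls       = cong (true ∷_) (zeroMask-extendLabels ms ls)
zeroMask-extendLabels (false ∷ ms) (l ∷ ls) = cong (false ∷_) (zeroMask-extendLabels ms ls)

extendLabels-restLabels : ∀ {n} (ls : Vec ℕ n) → extendLabels (zeroMask ls) (restLabels (zeroMask ls) ls) ≡ ls
extendLabels-restLabels []           = refl
extendLabels-restLabels (zero  ∷ ls) = cong (0 ∷_) (extendLabels-restLabels ls)
extendLabels-restLabels (suc l ∷ ls) = cong (suc l ∷_) (extendLabels-restLabels ls)

restLabels-extendLabels : ∀ {n} (ms : Vec Bool n) ls → restLabels ms (extendLabels ms ls) ≡ ls
restLabels-extendLabels ms ls = trans (cong (Vec.map pred) (reject-merge ms (Vec.replicate (#in ms) 0) (Vec.map suc ls)))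
                                      (trans (sym (Vecₚ.map-∘ pred suc ls)) (Vecₚ.map-id ls))

rgsFrom-suc∷ : ∀ l b {n} (ls : Vec ℕ n) →
  rgsFrom (suc b) (suc l ∷ ls) ≡ (l ≤ᵇ b) ∧ rgsFrom (suc (if l ≡ᵇ b then suc b else b)) ls
rgsFrom-suc∷ l b ls = cong₂ _∧_ (suc≤ᵇsuc l) (cong (λ b′ → rgsFrom b′ ls) (if-suc (l ≡ᵇ b)))
  where
  suc≤ᵇsuc : ∀ l → (suc l ≤ᵇ suc b) ≡ (l ≤ᵇ b)
  suc≤ᵇsuc zero    = refl
  suc≤ᵇsuc (suc l) = refl
  if-suc : ∀ β → (if β then suc (suc b) else suc b) ≡ suc (if β then suc b else b)
  if-suc true  = refl
  if-suc false = refl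

rgsFrom-restLabels : ∀ b {n} (ls : Vec ℕ n) → rgsFrom (suc b) ls ≡ rgsFrom b (restLabels (zeroMask ls) ls)
rgsFrom-restLabels b []           = refl
rgsFrom-restLabels b (zero  ∷ ls) = rgsFrom-restLabels b ls
rgsFrom-restLabels b (suc l ∷ ls) = trans (rgsFrom-suc∷ l b ls) (cong ((l ≤ᵇ b) ∧_) (rgsFrom-restLabels _ ls))

rgsFrom-extendLabels : ∀ b {n} (ms : Vec Bool n) ls → rgsFrom (suc b) (extendLabels ms ls) ≡ rgsFrom b ls
rgsFrom-extendLabels b []           []       = refl
rgsFrom-extendLabels b (true  ∷ ms) ls       = rgsFrom-extendLabels b ms ls
rgsFrom-extendLabels b (false ∷ ms) (l ∷ ls) =
  trans (rgsFrom-suc∷ l b (extendLabels ms ls)) (cong ((l ≤ᵇ b) ∧_) (rgsFrom-extendLabels _ ms ls))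

module ColoredPartitions {c : ℕ} (a : Fin c) (m : ℕ) where

  open BoundedColorings a

  #aInBlock : ∀ {n} → Vec ℕ n → Vec (Fin c) n → ℕ → ℕ
  #aInBlock ls cs j = blockColorCount ls cs j a

  #aInBlock-beyond : ∀ b {n} (ls : Vec ℕ n) (cs : Vec (Fin c) n) j → rgsFrom b ls ≡ true → b + n ≤ j → #aInBlock ls cs j ≡ 0
  #aInBlock-beyond b []       []       j rgs b+n≤j = refl
  #aInBlock-beyond b {suc n} (l ∷ ls) (x ∷ cs) j rgs b+n≤j =
    cong₂ _+_ (cong (λ z → if z ∧ isA x then 1 else 0) (≢⇒≡ᵇ≡false (ℕ.<⇒≢ l<j)))
              (#aInBlock-beyond _ ls cs j (Bool.∧-conicalʳ _ _ rgs) next+n≤j)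
    where
    l≤b : l ≤ b
    l≤b = ≤ᵇ≡true⇒≤ (Bool.∧-conicalˡ _ _ rgs)
    b+1+n≤j : suc b + n ≤ j
    b+1+n≤j = subst (_≤ j) (ℕ.+-suc b n) b+n≤j
    l<j : l < j
    l<j = ℕ.<-≤-trans (s≤s (ℕ.≤-trans l≤b (ℕ.m≤m+n b n))) b+1+n≤j
    next≤suc : ∀ β → (if β then suc b else b) ≤ suc b
    next≤suc true  = ℕ.≤-refl
    next≤suc false = ℕ.n≤1+n b
    next+n≤j : (if l ≡ᵇ b then suc b else b) + n ≤ j
    next+n≤j = ℕ.≤-trans (ℕ.+-monoˡ-≤ n (next≤suc (l ≡ᵇ b))) b+1+n≤j

  #aInBlock-zero : ∀ {n} (ls : Vec ℕ n) cs → #aInBlock ls cs 0 ≡ #a (select (zeroMask ls) cs)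
  #aInBlock-zero []           []       = refl
  #aInBlock-zero (zero  ∷ ls) (x ∷ cs) = cong (δₐ x +_) (#aInBlock-zero ls cs)
  #aInBlock-zero (suc l ∷ ls) (x ∷ cs) = #aInBlock-zero ls cs

  #aInBlock-suc : ∀ {n} (ls : Vec ℕ n) cs j →
    #aInBlock ls cs (suc j) ≡ #aInBlock (restLabels (zeroMask ls) ls) (reject (zeroMask ls) cs) j
  #aInBlock-suc []           []       j = refl
  #aInBlock-suc (zero  ∷ ls) (x ∷ cs) j = #aInBlock-suc ls cs j
  #aInBlock-suc (suc l ∷ ls) (x ∷ cs) j = cong ((if (l ≡ᵇ j) ∧ isA x then 1 else 0) +_) (#aInBlock-suc ls cs j)

  #aInBlock-extend-zero : ∀ {n} (ms : Vec Bool n) bcs ls rcs → #aInBlock (extendLabels ms ls) (merge ms bcs rcs) 0 ≡ #a bcs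
  #aInBlock-extend-zero []           []         []       []         = refl
  #aInBlock-extend-zero (true  ∷ ms) (x ∷ bcs) ls        rcs        = cong (δₐ x +_) (#aInBlock-extend-zero ms bcs ls rcs)
  #aInBlock-extend-zero (false ∷ ms) bcs        (l ∷ ls) (x ∷ rcs) = #aInBlock-extend-zero ms bcs ls rcs

  #aInBlock-extend-suc : ∀ {n} (ms : Vec Bool n) bcs ls rcs j →
    #aInBlock (extendLabels ms ls) (merge ms bcs rcs) (suc j) ≡ #aInBlock ls rcs j
  #aInBlock-extend-suc []           []         []       []         j = refl
  #aInBlock-extend-suc (true  ∷ ms) (x ∷ bcs) ls        rcs        j = #aInBlock-extend-suc ms bcs ls rcs j
  #aInBlock-extend-suc (false ∷ ms) bcs        (l ∷ ls) (x ∷ rcs) j =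
    cong ((if (l ≡ᵇ j) ∧ isA x then 1 else 0) +_) (#aInBlock-extend-suc ms bcs ls rcs j)

  avoids : ∀ {n} → Vec ℕ n → Vec (Fin c) n → Bool
  avoids {n} ls cs = allᵇ (λ j → #aInBlock ls cs j ≤ᵇ m) (List.upTo n)

  avoids⇒ : ∀ {n} ls cs → avoids {n} ls cs ≡ true → ∀ j → j < n → #aInBlock ls cs j ≤ m
  avoids⇒ {n} ls cs avoid j j<n = ≤ᵇ≡true⇒≤ (allᵇ-⇒ (λ j → #aInBlock ls cs j ≤ᵇ m) n (λ z → z) avoid j j<n)

  ⇒avoids : ∀ {n} ls cs → (∀ j → j < n → #aInBlock ls cs j ≤ m) → avoids {n} ls cs ≡ true
  ⇒avoids {n} ls cs bounded = allᵇ-⇐ (λ j → #aInBlock ls cs j ≤ᵇ m) n (λ z → z) (λ j j<n → ≤⇒≤ᵇ≡true (bounded j j<n))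

  Avoiding : ℕ → Set
  Avoiding n = Σ (Vec ℕ n) λ ls → Σ (Vec (Fin c) n) λ cs → (rgsFrom 0 ls ≡ true) × (avoids ls cs ≡ true)

  AvoidingPartition↔Avoiding : ∀ n → AvoidingPartition n c m a ↔ Avoiding n
  AvoidingPartition↔Avoiding n = mk↔ₛ′
    (λ { (colPart ls rgs cs , avoid) → ls , cs , rgs , avoid }) (λ { (ls , cs , rgs , avoid) → colPart ls rgs cs , avoid })
    (λ _ → refl) (λ _ → refl)

  WithFirstBlock : ∀ n → Vec Bool n → Set
  WithFirstBlock n ms = Σ (Vec ℕ n) λ ls → Σ (Vec (Fin c) n) λ cs → Σ (Fin c) λ c₀ →
    (zeroMask ls ≡ ms) × (rgsFrom 1 ls ≡ true) × (avoids (0 ∷ ls) (c₀ ∷ cs) ≡ true)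

  Avoiding-suc↔ : ∀ n → Avoiding (suc n) ↔ Σ (Vec Bool n) (WithFirstBlock n)
  Avoiding-suc↔ n = mk↔ₛ′
    (λ { (zero ∷ ls , c₀ ∷ cs , rgs , avoid) → zeroMask ls , ls , cs , c₀ , refl , rgs , avoid
       ; (suc _ ∷ _ , _ ∷ _ , () , _) })
    (λ (_ , ls , cs , c₀ , _ , rgs , avoid) → 0 ∷ ls , c₀ ∷ cs , rgs , avoid)
    (λ { (_ , _ , _ , _ , refl , _ , _) → refl })
    (λ { (zero ∷ _ , _ ∷ _ , _ , _) → refl ; (suc _ ∷ _ , _ ∷ _ , () , _) })

  block-bound : ∀ {n} (ms : Vec Bool n) ls cs c₀ → zeroMask ls ≡ ms → avoids (0 ∷ ls) (c₀ ∷ cs) ≡ true →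
    #a (c₀ ∷ select ms cs) ≤ m
  block-bound .(zeroMask ls) ls cs c₀ refl avoid =
    subst (λ z → δₐ c₀ + z ≤ m) (#aInBlock-zero ls cs) (avoids⇒ (0 ∷ ls) (c₀ ∷ cs) avoid 0 (s≤s z≤n))

  rest-rgs : ∀ {n} (ms : Vec Bool n) ls → zeroMask ls ≡ ms → rgsFrom 1 ls ≡ true → rgsFrom 0 (restLabels ms ls) ≡ true
  rest-rgs .(zeroMask ls) ls refl rgs = trans (sym (rgsFrom-restLabels 0 ls)) rgs

  rest-avoids : ∀ {n} (ms : Vec Bool n) ls cs c₀ → zeroMask ls ≡ ms → avoids (0 ∷ ls) (c₀ ∷ cs) ≡ true →
    avoids (restLabels ms ls) (reject ms cs) ≡ true
  rest-avoids .(zeroMask ls) ls cs c₀ refl avoid = ⇒avoids (restLabels (zeroMask ls) ls) (reject (zeroMask ls) cs)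
    (λ j j<rest → subst (_≤ m) (#aInBlock-suc ls cs j)
                    (avoids⇒ (0 ∷ ls) (c₀ ∷ cs) avoid (suc j) (s≤s (ℕ.≤-trans j<rest (#out≤ (zeroMask ls))))))

  split-block : ∀ {n} (ms : Vec Bool n) → WithFirstBlock n ms → Coloring≤ (suc (#in ms)) m × Avoiding (#out ms)
  split-block ms (ls , cs , c₀ , mask , rgs , avoid) =
    (c₀ ∷ select ms cs , block-bound ms ls cs c₀ mask avoid) ,
    (restLabels ms ls , reject ms cs , rest-rgs ms ls mask rgs , rest-avoids ms ls cs c₀ mask avoid)

  join-block : ∀ {n} (ms : Vec Bool n) → Coloring≤ (suc (#in ms)) m × Avoiding (#out ms) → WithFirstBlock n ms
  join-block {n} ms ((c₀ ∷ bcs , block≤m) , (ls , rcs , rgs , avoid)) =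
    extendLabels ms ls , merge ms bcs rcs , c₀ , zeroMask-extendLabels ms ls , trans (rgsFrom-extendLabels 0 ms ls) rgs ,
    ⇒avoids (0 ∷ extendLabels ms ls) (c₀ ∷ merge ms bcs rcs) bounded
    where
    bounded : ∀ j → j < suc n → #aInBlock (0 ∷ extendLabels ms ls) (c₀ ∷ merge ms bcs rcs) j ≤ m
    bounded zero    _ = subst (λ z → δₐ c₀ + z ≤ m) (sym (#aInBlock-extend-zero ms bcs ls rcs)) block≤m
    bounded (suc j) _ with j ℕ.<? #out ms
    ... | yes j<rest = subst (_≤ m) (sym (#aInBlock-extend-suc ms bcs ls rcs j)) (avoids⇒ ls rcs avoid j j<rest)
    ... | no  j≮rest = subst (_≤ m) (sym (trans (#aInBlock-extend-suc ms bcs ls rcs j)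
                                                 (#aInBlock-beyond 0 ls rcs j rgs (ℕ.≮⇒≥ j≮rest)))) z≤n

  ≡-split : ∀ {k r} {bcs bcs′ : Vec (Fin c) k} {ls ls′ : Vec ℕ r} {rcs rcs′ : Vec (Fin c) r}
    {b : #a bcs ≤ m} {b′ : #a bcs′ ≤ m} {g : rgsFrom 0 ls ≡ true} {g′ : rgsFrom 0 ls′ ≡ true}
    {v : avoids ls rcs ≡ true} {v′ : avoids ls′ rcs′ ≡ true} →
    bcs ≡ bcs′ → ls ≡ ls′ → rcs ≡ rcs′ →
    _≡_ {A = Coloring≤ k m × Avoiding r} ((bcs , b) , (ls , rcs , g , v)) ((bcs′ , b′) , (ls′ , rcs′ , g′ , v′))
  ≡-split {b = b} {b′} {g} {g′} {v} {v′} refl refl refl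
    rewrite ℕ.≤-irrelevant b b′ | bool-irrelevant g g′ | bool-irrelevant v v′ = refl

  ≡-WithFirstBlock : ∀ {n} {ms : Vec Bool n} {ls ls′ : Vec ℕ n} {cs cs′ : Vec (Fin c) n} {c₀}
    {e : zeroMask ls ≡ ms} {e′ : zeroMask ls′ ≡ ms} {g : rgsFrom 1 ls ≡ true} {g′ : rgsFrom 1 ls′ ≡ true}
    {v : avoids (0 ∷ ls) (c₀ ∷ cs) ≡ true} {v′ : avoids (0 ∷ ls′) (c₀ ∷ cs′) ≡ true} →
    ls ≡ ls′ → cs ≡ cs′ → _≡_ {A = WithFirstBlock n ms} (ls , cs , c₀ , e , g , v) (ls′ , cs′ , c₀ , e′ , g′ , v′)
  ≡-WithFirstBlock {e = e} {e′} {g} {g′} {v} {v′} refl refl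
    rewrite mask-irrelevant e e′ | bool-irrelevant g g′ | bool-irrelevant v v′ = refl

  split-join-block : ∀ {n} (ms : Vec Bool n) y → split-block ms (join-block ms y) ≡ y
  split-join-block ms ((c₀ ∷ bcs , _) , (ls , rcs , _ , _)) =
    ≡-split (cong (c₀ ∷_) (select-merge ms bcs rcs)) (restLabels-extendLabels ms ls) (reject-merge ms bcs rcs)

  join-split-block : ∀ {n} (ms : Vec Bool n) x → join-block ms (split-block ms x) ≡ x
  join-split-block .(zeroMask ls) (ls , cs , c₀ , refl , _ , _) =
    ≡-WithFirstBlock (extendLabels-restLabels ls) (merge-select-reject (zeroMask ls) cs)

  WithFirstBlock↔ : ∀ {n} (ms : Vec Bool n) → WithFirstBlock n ms ↔ (Coloring≤ (suc (#in ms)) m × Avoiding (#out ms))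
  WithFirstBlock↔ ms = mk↔ₛ′ (split-block ms) (join-block ms) (split-join-block ms) (join-split-block ms)

-- Counting avoiding colored partitions

module Count {c : ℕ} (a : Fin c) (m : ℕ) where

  open BoundedColorings a
  open ColoredPartitions a m
  open ExponentialFormula (λ p → fromℕ (innerSum c m p))
  open PartitionWeights (λ p → fromℕ (innerSum c m p))

  Counted : ℕ → Set
  Counted r = Σ ℕ (λ N → (Avoiding r ↔ Fin N) × (fromℕ N ≡ R r))

  counted-zero : Counted 0
  counted-zero = 1
    , ↔-trans (mk↔ₛ′ (λ _ → tt) (λ _ → [] , [] , refl , refl) (λ _ → refl) (λ { ([] , [] , refl , refl) → refl }))
              (↔-sym Finₚ.1↔⊤)
    , sym (ℚ.*-identityʳ (fromℕ 1))

  #Avoiding-suc : ℕ → (ℕ → ℕ) → ℕ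
  #Avoiding-suc n N = ∑Subsets n (λ ms → #Coloring≤ (suc (#in ms)) m * N (#out ms))

  Avoiding-suc↔Fin : ∀ n (N : ℕ → ℕ) → (∀ r → r ≤ n → Avoiding r ↔ Fin (N r)) → Avoiding (suc n) ↔ Fin (#Avoiding-suc n N)
  Avoiding-suc↔Fin n N Avoiding↔N = ↔-trans (Avoiding-suc↔ n) (↔-trans (Σ-↔ ↔-refl (λ {ms} → WithFirstBlock↔ ms))
    (Σ-Subsets↔Fin n (λ ms → Coloring≤ (suc (#in ms)) m × Avoiding (#out ms)) (λ ms → #Coloring≤ (suc (#in ms)) m * N (#out ms))
      (λ ms → ↔Fin-× (Coloring≤↔Fin (suc (#in ms)) m) (Avoiding↔N (#out ms) (#out≤ ms)))))

  #Avoiding-suc≡R : ∀ n (N : ℕ → ℕ) → (∀ r → r ≤ n → fromℕ (N r) ≡ R r) → fromℕ (#Avoiding-suc n N) ≡ R (suc n)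
  #Avoiding-suc≡R n N N≡R = begin
    fromℕ (#Avoiding-suc n N)
      ≡⟨ cong fromℕ (∑Subsets-binomial n (λ k l → #Coloring≤ (suc k) m * N l)) ⟩
    fromℕ (∑ℕ.∑< (suc n) (λ k → (n C k) * (#Coloring≤ (suc k) m * N (n ∸ k))))
      ≡⟨ fromℕ-∑< (suc n) (λ k → (n C k) * (#Coloring≤ (suc k) m * N (n ∸ k))) ⟩
    ∑< (suc n) (λ k → fromℕ ((n C k) * (#Coloring≤ (suc k) m * N (n ∸ k))))
      ≡⟨ ∑ℚ.∑<-cong (suc n) summand ⟩
    ∑< (suc n) (λ k → fromℕ (n C k) *ℚ fromℕ (innerSum c m (suc k)) *ℚ R (n ∸ k))
      ≡⟨ R-suc n ⟨
    R (suc n) ∎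
    where
    open ≡-Reasoning
    summand : ∀ k → k < suc n →
      fromℕ ((n C k) * (#Coloring≤ (suc k) m * N (n ∸ k))) ≡ fromℕ (n C k) *ℚ fromℕ (innerSum c m (suc k)) *ℚ R (n ∸ k)
    summand k _ = begin
      fromℕ ((n C k) * (#Coloring≤ (suc k) m * N (n ∸ k)))
        ≡⟨ trans (fromℕ-homo-* (n C k) (#Coloring≤ (suc k) m * N (n ∸ k)))
                 (cong (fromℕ (n C k) *ℚ_) (fromℕ-homo-* (#Coloring≤ (suc k) m) (N (n ∸ k)))) ⟩
      fromℕ (n C k) *ℚ (fromℕ (#Coloring≤ (suc k) m) *ℚ fromℕ (N (n ∸ k)))
        ≡⟨ cong₂ (λ x y → fromℕ (n C k) *ℚ (fromℕ x *ℚ y))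
                 (#Coloring≤≡innerSum (suc k) m) (N≡R (n ∸ k) (ℕ.m∸n≤m n k)) ⟩
      fromℕ (n C k) *ℚ (fromℕ (innerSum c m (suc k)) *ℚ R (n ∸ k))
        ≡⟨ ℚ.*-assoc (fromℕ (n C k)) (fromℕ (innerSum c m (suc k))) (R (n ∸ k)) ⟨
      fromℕ (n C k) *ℚ fromℕ (innerSum c m (suc k)) *ℚ R (n ∸ k) ∎

  counted-suc : ∀ n → (∀ {r} → r < suc n → Counted r) → Counted (suc n)
  counted-suc n counted-below =
    #Avoiding-suc n N ,
    Avoiding-suc↔Fin n N (λ r r≤n → proj₁ (N-counts r r≤n)) ,
    #Avoiding-suc≡R n N (λ r r≤n → proj₂ (N-counts r r≤n))
    where
    -- Only N r for r ≤ n matters; the junk value 0 makes N a plain function of r.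
    N′ : ∀ r → Dec (r ≤ n) → ℕ
    N′ r (yes r≤n) = proj₁ (counted-below (s≤s r≤n))
    N′ r (no  _)   = 0
    N : ℕ → ℕ
    N r = N′ r (r ℕ.≤? n)
    N′-counts : ∀ r (r≤n? : Dec (r ≤ n)) → r ≤ n → (Avoiding r ↔ Fin (N′ r r≤n?)) × (fromℕ (N′ r r≤n?) ≡ R r)
    N′-counts r (yes r≤n) _   = proj₂ (counted-below (s≤s r≤n))
    N′-counts r (no  r≰n) r≤n = ⊥-elim (r≰n r≤n)
    N-counts : ∀ r → r ≤ n → (Avoiding r ↔ Fin (N r)) × (fromℕ (N r) ≡ R r)
    N-counts r = N′-counts r (r ℕ.≤? n)

  counted : ∀ n → Counted n
  counted = <-rec Counted λ where
    zero    _             → counted-zero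
    (suc n) counted-below → counted-suc n counted-below

  term≡ : ∀ n p → term n c m p ≡ fromℕ (n !) *ℚ weight n p
  term≡ n p = trans
    (solve 4 (λ f i μ w → f :* i :* μ :* w := f :* (i :* μ :* w)) refl
      (fromℕ (n !)) (productℚ (List.map inv! p)) (multiplicityFactor n p) (productℚ (List.map (λ q → fromℕ (innerSum c m q)) p)))
    (cong (fromℕ (n !) *ℚ_) (sym (weight≡ n p)))

  ∑term≡R : ∀ n L → Unique L → (∀ p → (p ∈ L) ⇔ IsIntPartition n p) → sumℚ (List.map (term n c m) L) ≡ R n
  ∑term≡R n L unique-L L⇔ = begin
    sumℚ (List.map (term n c m) L)                              ≡⟨ sumℚ-map-cong L (λ {p} _ → term≡ n p) ⟩
    sumℚ (List.map (λ p → fromℕ (n !) *ℚ weight n p) L)          ≡⟨ sumℚ-map-*ˡ (fromℕ (n !)) (weight n) L ⟩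
    fromℕ (n !) *ℚ sumℚ (List.map (weight n) L)                 ≡⟨ cong (fromℕ (n !) *ℚ_) (∑weight≡G-over n L unique-L L⇔) ⟩
    R n ∎
    where open ≡-Reasoning

theorem5p1 : (n c m : ℕ) → (a : Fin c) → 1 ≤ n → 1 ≤ m →
    (L : List (List ℕ)) → Unique L → ((p : List ℕ) → (p ∈ L) ⇔ IsIntPartition n p) →
    Σ ℕ (λ N → (AvoidingPartition n c m a ↔ Fin N)
    × (fromℕ N ≡ sumℚ (map (term n c m) L)))
theorem5p1 n c m a _ _ L unique-L L⇔ =
  let N , Avoiding↔N , N≡R = Count.counted a m n in
  N , ↔-trans (ColoredPartitions.AvoidingPartition↔Avoiding a m n) Avoiding↔N ,
  trans N≡R (sym (Count.∑term≡R a m n L unique-L L⇔))
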